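{- Let $L$ be a planar integral lattice with $\nu(L)\equiv 3\pmod 4$, and suppose the largest prime factor $p$ of $\nu(L)$ satisfies $p<17$. Then $L$ contains a convex equilateral $n$-gon for every integer $n\geq p$.
   Context: A planar lattice is a set $L[\mathbf{a},\mathbf{b}]=\{m\mathbf{a}+n\mathbf{b}\mid m,n\in\mathbb{Z}\}\subset\mathbb{R}^2$ for linearly independent vectors $\mathbf{a},\mathbf{b}\in\mathbb{R}^2$. It is integral if $\mathbf{x}\cdot\mathbf{y}\in\mathbb{Z}$ for all $\mathbf{x},\mathbf{y}\in L$. $D(L)=|\det(\mathbf{a},\mathbf{b})|$ is the area of a fundamental parallelogram (independent of the choice of generators); for integral $L$, $D(L)^2$ is a positive integer, and $\nu(L)$ denotes its square-free part, i.e. the square-free positive integer with $D(L)^2=k^2\nu(L)$ for some integer $k$. An equilateral $n$-gon is a polygon with $n$ vertices whose sides all have equal length; a set $S$ contains a polygon if every vertex of the polygon lies in $S$. -}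

module Defs where

open import Data.Nat as ℕ using (ℕ; suc; NonZero)
open import Data.Nat.DivMod using (_%_; m%n<n)
open import Data.Nat.Divisibility using (_∣_)
open import Data.Nat.Primality using (Prime)
open import Data.Integer as ℤ using (ℤ; +_; _+_; _-_; _*_; _<_; _≤_)
open import Data.Fin using (Fin; toℕ; fromℕ<)
open import Data.Product using (_×_; _,_; Σ; ∃)
open import Data.Sum using (_⊎_)
open import Relation.Binary.PropositionalEquality using (_≡_; _≢_)

-- A planar integral lattice L = L[a,b] is described (up to isometry) by its
-- Gram matrix  ( A  B ; B  C )  with A = a·a, B = a·b, C = b·b ∈ ℤ.
-- Linear independence of a, b  ⇔  the Gram matrix is positive definite.
record IntegralLattice : Set where
  constructor gram
  field
    A B C : ℤ
    A-pos : + 0 < A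
    det-pos : + 0 < A * C - B * B

open IntegralLattice public

-- D(L)^2 = det(a,b)^2 = A C - B^2, a positive integer.
D² : IntegralLattice → ℤ
D² L = A L * C L - B L * B L

-- Lattice points are written in coordinates (m , n) ↦ m a + n b.
Point : Set
Point = ℤ × ℤ

_⊖_ : Point → Point → Point
(x₁ , y₁) ⊖ (x₂ , y₂) = (x₁ - x₂ , y₁ - y₂)

normSq : IntegralLattice → Point → ℤ
normSq L (m , n) = A L * (m * m) + (+ 2) * (B L * (m * n)) + C L * (n * n)

-- det(m₁a+n₁b , m₂a+n₂b) = (m₁n₂ - m₂n₁) · det(a,b); we record the
-- coordinate factor (the sign of det(a,b) is fixed, so orientation
-- tests only differ by a global sign, which ConvexPolygon allows for).
cross : Point → Point → ℤ
cross (m₁ , n₁) (m₂ , n₂) = m₁ * n₂ - m₂ * n₁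

next : ∀ {n} → Fin n → Fin n
next {suc k} i = fromℕ< (m%n<n (suc (toℕ i)) (suc k))

SquareFree : ℕ → Set
SquareFree m = 0 ℕ.< m × (∀ d → d ℕ.* d ∣ m → d ≡ 1)

SquareFreePart : ℕ → ℕ → Set
SquareFreePart N ν = SquareFree ν × ∃ λ k → N ≡ k ℕ.* k ℕ.* ν

Nu : IntegralLattice → ℕ → Set
Nu L ν = SquareFreePart (ℤ.∣ D² L ∣) ν

LargestPrimeFactor : ℕ → ℕ → Set
LargestPrimeFactor p m = Prime p × p ∣ m × (∀ q → Prime q → q ∣ m → q ℕ.≤ p)

ConvexPolygon : ∀ {n} → (Fin n → Point) → Set
ConvexPolygon {n} v =
  3 ℕ.≤ n ×
  ( (∀ i j → j ≢ i → j ≢ next i → + 0 < cross (v (next i) ⊖ v i) (v j ⊖ v i))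
  ⊎ (∀ i j → j ≢ i → j ≢ next i → cross (v (next i) ⊖ v i) (v j ⊖ v i) < + 0))

Equilateral : ∀ {n} → IntegralLattice → (Fin n → Point) → Set
Equilateral L v = ∀ i j → normSq L (v (next i) ⊖ v i) ≡ normSq L (v (next j) ⊖ v j)

ContainsConvexEquilateral : IntegralLattice → ℕ → Set
ContainsConvexEquilateral L n =
  Σ (Fin n → Point) λ v → ConvexPolygon v × Equilateral L v

module Submission where

-- A sequence of edge vectors whose directions increase through exactly one full turn, turning left
-- at every vertex (also from the last edge back to the first) and summing to zero, bounds a convex polygon:
-- the cross products of an edge with the other edges, read cyclically from the next edge on, are positive along
-- a run and then non-positive, so every partial sum, i.e. every vertex, lies strictly to the left of the edge.
--
-- In the lattice ℤ × √ν ℤ, of squared norm x² + ν y², the vector γ m = (m² - ν , 2 m), which is (m + √-ν)²,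
-- has norm (m² + ν)², and its direction decreases to 0 as m grows. Take a seed polygon with q sides, q the
-- largest prime factor of ν, or the rhombus with sides (± (ν - 1) , ± 2), insert the pairs ± γ m for
-- m = K, …, K + r - 1 in front of its upper and of its lower half, and stretch every edge to a common length:
-- this gives convex equilateral polygons with q + 2 r and 4 + 2 r sides. As D(L)² = k² ν, a linear map
-- multiplying all squared lengths by the same factor carries them into L. Finally, a squarefree ν ≡ 3 (mod 4)
-- whose prime factors are below 17 divides 2 · 3 · 5 · 7 · 11 · 13, which leaves sixteen values of ν, each
-- with a seed found by computer search.

open import Defs
open import Data.Bool using (if_then_else_)
open import Data.Empty using (⊥; ⊥-elim)
open import Data.Fin using (Fin; toℕ; fromℕ<)
import Data.Fin.Properties as FinP
open import Data.Integer as ℤ using (ℤ; +_; -[1+_]; +[1+_]; 0ℤ; _+_; _-_; _*_; -_; +<+; +≤+; -<+)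
import Data.Integer.Properties as ℤP
open import Data.Integer.Tactic.RingSolver using (solve-∀)
open import Data.Nat as ℕ using (ℕ; zero; suc; _≤_; _<_; _%_; _≡ᵇ_; _≤′_; ≤′-refl; ≤′-step; z≤n; s≤s; z<s)
open import Data.Nat.DivMod using (m<n⇒m%n≡m; n%n≡0)
open import Data.Nat.Divisibility using (_∣_; _∣?_; divides; ∣-trans; *-monoʳ-∣; m∣m*n)
open import Data.Nat.ListAction using (product)
open import Data.Nat.Primality using (Prime; prime?; prime⇒nonTrivial)
open import Data.Nat.Primality.Factorisation using (factorise)
import Data.Nat.Properties as ℕP
import Data.Nat.Tactic.RingSolver as ℕ-Solver
open import Data.List using (List; []; _∷_; length; foldr; last; head; _++_; map; applyDownFrom)
import Data.List.Properties as List
open import Data.List.Membership.DecPropositional ℕP._≟_ using (_∈?_)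
open import Data.List.Membership.Propositional using (_∈_)
open import Data.List.Membership.Propositional.Properties using (∈-++⁺ˡ; ∈-++⁺ʳ; ∈-map⁺)
open import Data.List.Relation.Binary.Pointwise as Pointwise using (Pointwise; []; _∷_)
open import Data.List.Relation.Binary.Pointwise.Properties using (Pointwise-length)
open import Data.List.Relation.Unary.All as All using (All; []; _∷_; all?)
import Data.List.Relation.Unary.All.Properties as All
open import Data.List.Relation.Unary.Any using (here; there)
open import Data.List.Relation.Unary.Linked as Linked using (Linked; []; [-]; _∷_; linked?)
import Data.List.Relation.Unary.Linked.Properties as Linked
open import Data.Maybe as Maybe using (just)
open import Data.Maybe.Relation.Binary.Connected using (Connected; just; nothing-just; drop-just; connected?)
open import Data.Product using (_×_; _,_; proj₁; proj₂; ∃)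
open import Data.Product.Properties using (≡-dec)
open import Data.Sum as Sum using (_⊎_; inj₁; inj₂)
open import Data.Unit using (tt)
open import Relation.Binary using (Transitive; tri<; tri≈; tri>)
open import Relation.Binary.PropositionalEquality using (_≡_; _≢_; refl; sym; trans; cong; cong₂; subst; module ≡-Reasoning)
open import Relation.Nullary using (¬_; Dec; yes; no; _×-dec_; _⊎-dec_; _→-dec_)
open import Relation.Nullary.Decidable using (map′; toWitness)

*-pos : ∀ {i j} → 0ℤ ℤ.< i → 0ℤ ℤ.< j → 0ℤ ℤ.< i * j
*-pos {+[1+ _ ]} {+[1+ _ ]} _ _ = +<+ z<s
*-pos {+ 0} (+<+ ()) _
*-pos {+[1+ _ ]} {+ 0} _ (+<+ ())

*-pos-nonNeg : ∀ {i j} → 0ℤ ℤ.< i → 0ℤ ℤ.≤ j → 0ℤ ℤ.≤ i * j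
*-pos-nonNeg {+[1+ n ]} {+ 0} _ _ = ℤP.≤-reflexive (sym (ℤP.*-zeroʳ +[1+ n ]))
*-pos-nonNeg {+[1+ _ ]} {+[1+ _ ]} _ _ = +≤+ z≤n
*-pos-nonNeg {+ 0} (+<+ ()) _

*-pos-neg : ∀ {i j} → 0ℤ ℤ.< i → j ℤ.< 0ℤ → i * j ℤ.< 0ℤ
*-pos-neg {+[1+ _ ]} { -[1+ _ ]} _ _ = -<+
*-pos-neg {+ 0} (+<+ ()) _
*-pos-neg {+[1+ _ ]} {+ 0} _ (+<+ ())

*-cancelˡ-pos : ∀ {i j} → 0ℤ ℤ.< i → 0ℤ ℤ.< i * j → 0ℤ ℤ.< j
*-cancelˡ-pos {+[1+ _ ]} {+[1+ _ ]} _ _ = +<+ z<s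
*-cancelˡ-pos {+[1+ n ]} {+ 0} _ p = subst (0ℤ ℤ.<_) (ℤP.*-zeroʳ +[1+ n ]) p
*-cancelˡ-pos {+ 0} (+<+ ()) _

i<j⇒0<j-i : ∀ {i j} → i ℤ.< j → 0ℤ ℤ.< j - i
i<j⇒0<j-i {i} {j} i<j = subst (ℤ._< j - i) (ℤP.+-inverseʳ i) (ℤP.+-monoˡ-< (- i) i<j)

0ᵥ : Point
0ᵥ = 0ℤ , 0ℤ

infixl 6 _+ᵥ_
_+ᵥ_ : Point → Point → Point
(x₁ , y₁) +ᵥ (x₂ , y₂) = x₁ + x₂ , y₁ + y₂

-ᵥ_ : Point → Point
-ᵥ (x , y) = - x , - y

infixr 7 _·ᵥ_
_·ᵥ_ : ℤ → Point → Point
s ·ᵥ (x , y) = s * x , s * y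

+ᵥ-assoc : ∀ a b c → (a +ᵥ b) +ᵥ c ≡ a +ᵥ (b +ᵥ c)
+ᵥ-assoc (a₁ , a₂) (b₁ , b₂) (c₁ , c₂) = cong₂ _,_ (ℤP.+-assoc a₁ b₁ c₁) (ℤP.+-assoc a₂ b₂ c₂)

+ᵥ-comm : ∀ a b → a +ᵥ b ≡ b +ᵥ a
+ᵥ-comm (a₁ , a₂) (b₁ , b₂) = cong₂ _,_ (ℤP.+-comm a₁ b₁) (ℤP.+-comm a₂ b₂)

·ᵥ-assoc : ∀ s t x → s ·ᵥ t ·ᵥ x ≡ (s * t) ·ᵥ x
·ᵥ-assoc s t (x₁ , x₂) = cong₂ _,_ (sym (ℤP.*-assoc s t x₁)) (sym (ℤP.*-assoc s t x₂))

neg-·ᵥ : ∀ s x → -ᵥ (s ·ᵥ x) ≡ s ·ᵥ -ᵥ x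
neg-·ᵥ s (x₁ , x₂) = cong₂ _,_ (ℤP.neg-distribʳ-* s x₁) (ℤP.neg-distribʳ-* s x₂)

+ᵥ-⊖-cancel : ∀ w x → (w +ᵥ x) ⊖ w ≡ x
+ᵥ-⊖-cancel (w₁ , w₂) (x₁ , x₂) = cong₂ _,_ (identity w₁ x₁) (identity w₂ x₂)
  where
  identity : ∀ w x → (w + x) - w ≡ x
  identity = solve-∀

+ᵥ≡0ᵥ⇒0ᵥ⊖ : ∀ {w x} → w +ᵥ x ≡ 0ᵥ → 0ᵥ ⊖ w ≡ x
+ᵥ≡0ᵥ⇒0ᵥ⊖ {w₁ , w₂} {x₁ , x₂} w+x≡0 =
  cong₂ _,_ (identity w₁ x₁ (cong proj₁ w+x≡0)) (identity w₂ x₂ (cong proj₂ w+x≡0))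
  where
  identity : ∀ w x → w + x ≡ 0ℤ → 0ℤ - w ≡ x
  identity w x w+x≡0 = trans (sym (ℤP.+-identityʳ (0ℤ - w))) (trans (cong (_+_ (0ℤ - w)) (sym w+x≡0)) (cancel w x))
    where
    cancel : ∀ w x → (0ℤ - w) + (w + x) ≡ x
    cancel = solve-∀

cross-antisym : ∀ a b → cross b a ≡ - cross a b
cross-antisym (a₁ , a₂) (b₁ , b₂) = identity a₁ a₂ b₁ b₂
  where
  identity : ∀ a₁ a₂ b₁ b₂ → b₁ * a₂ - a₁ * b₂ ≡ - (a₁ * b₂ - b₁ * a₂)
  identity = solve-∀

cross-self : ∀ a → cross a a ≡ 0ℤ
cross-self (a₁ , a₂) = identity a₁ a₂
  where
  identity : ∀ a₁ a₂ → a₁ * a₂ - a₁ * a₂ ≡ 0ℤ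
  identity = solve-∀

cross-0ᵥʳ : ∀ a → cross a 0ᵥ ≡ 0ℤ
cross-0ᵥʳ (a₁ , a₂) = identity a₁ a₂
  where
  identity : ∀ a₁ a₂ → a₁ * 0ℤ - 0ℤ * a₂ ≡ 0ℤ
  identity = solve-∀

cross-+ᵥʳ : ∀ a p q → cross a (p +ᵥ q) ≡ cross a p + cross a q
cross-+ᵥʳ (a₁ , a₂) (p₁ , p₂) (q₁ , q₂) = identity a₁ a₂ p₁ p₂ q₁ q₂
  where
  identity : ∀ a₁ a₂ p₁ p₂ q₁ q₂ →
    a₁ * (p₂ + q₂) - (p₁ + q₁) * a₂ ≡ (a₁ * p₂ - p₁ * a₂) + (a₁ * q₂ - q₁ * a₂)
  identity = solve-∀

cross-⊖ʳ : ∀ a p q → cross a (q ⊖ p) ≡ cross a q - cross a p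
cross-⊖ʳ (a₁ , a₂) (p₁ , p₂) (q₁ , q₂) = identity a₁ a₂ p₁ p₂ q₁ q₂
  where
  identity : ∀ a₁ a₂ p₁ p₂ q₁ q₂ →
    a₁ * (q₂ - p₂) - (q₁ - p₁) * a₂ ≡ (a₁ * q₂ - q₁ * a₂) - (a₁ * p₂ - p₁ * a₂)
  identity = solve-∀

cross-negˡ : ∀ a b → cross (-ᵥ a) b ≡ cross b a
cross-negˡ (a₁ , a₂) (b₁ , b₂) = identity a₁ a₂ b₁ b₂
  where
  identity : ∀ a₁ a₂ b₁ b₂ → (- a₁) * b₂ - b₁ * (- a₂) ≡ b₁ * a₂ - a₁ * b₂
  identity = solve-∀

cross-negʳ : ∀ a b → cross a (-ᵥ b) ≡ cross b a
cross-negʳ (a₁ , a₂) (b₁ , b₂) = identity a₁ a₂ b₁ b₂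
  where
  identity : ∀ a₁ a₂ b₁ b₂ → a₁ * (- b₂) - (- b₁) * a₂ ≡ b₁ * a₂ - a₁ * b₂
  identity = solve-∀

cross-neg-neg : ∀ a b → cross (-ᵥ a) (-ᵥ b) ≡ cross a b
cross-neg-neg (a₁ , a₂) (b₁ , b₂) = identity a₁ a₂ b₁ b₂
  where
  identity : ∀ a₁ a₂ b₁ b₂ → (- a₁) * (- b₂) - (- b₁) * (- a₂) ≡ a₁ * b₂ - b₁ * a₂
  identity = solve-∀

cross-·ᵥ : ∀ s t a b → cross (s ·ᵥ a) (t ·ᵥ b) ≡ (s * t) * cross a b
cross-·ᵥ s t (a₁ , a₂) (b₁ , b₂) = identity s t a₁ a₂ b₁ b₂
  where
  identity : ∀ s t a₁ a₂ b₁ b₂ →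
    (s * a₁) * (t * b₂) - (t * b₁) * (s * a₂) ≡ (s * t) * (a₁ * b₂ - b₁ * a₂)
  identity = solve-∀

LeftTurn : Point → Point → Set
LeftTurn a b = 0ℤ ℤ.< cross a b

leftTurn⇒swap-neg : ∀ {a b} → LeftTurn a b → cross b a ℤ.< 0ℤ
leftTurn⇒swap-neg {a} {b} p = subst (ℤ._< 0ℤ) (sym (cross-antisym a b)) (ℤP.neg-mono-< p)

leftTurn-·ᵥ : ∀ {s t a b} → 0ℤ ℤ.< s → 0ℤ ℤ.< t → LeftTurn a b → LeftTurn (s ·ᵥ a) (t ·ᵥ b)
leftTurn-·ᵥ {s} {t} {a} {b} 0<s 0<t p = subst (0ℤ ℤ.<_) (sym (cross-·ᵥ s t a b)) (*-pos (*-pos 0<s 0<t) p)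

-- Directions: half planes and the angular order

data Upper : Point → Set where
  above    : ∀ {x y} → 0ℤ ℤ.< y → Upper (x , y)
  positive : ∀ {x} → 0ℤ ℤ.< x → Upper (x , 0ℤ)

data Lower : Point → Set where
  below    : ∀ {x y} → y ℤ.< 0ℤ → Lower (x , y)
  negative : ∀ {x} → x ℤ.< 0ℤ → Lower (x , 0ℤ)

upper⇒¬lower : ∀ {a} → Upper a → ¬ Lower a
upper⇒¬lower (above 0<y) (below y<0) = ℤP.<-asym 0<y y<0
upper⇒¬lower (above 0<y) (negative _) = ℤP.<-irrefl refl 0<y
upper⇒¬lower (positive _) (below y<0) = ℤP.<-irrefl refl y<0
upper⇒¬lower (positive 0<x) (negative x<0) = ℤP.<-asym 0<x x<0

upper⇒lower-neg : ∀ {a} → Upper a → Lower (-ᵥ a)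
upper⇒lower-neg (above 0<y) = below (ℤP.neg-mono-< 0<y)
upper⇒lower-neg (positive 0<x) = negative (ℤP.neg-mono-< 0<x)

lower⇒upper-neg : ∀ {a} → Lower a → Upper (-ᵥ a)
lower⇒upper-neg (below y<0) = above (ℤP.neg-mono-< y<0)
lower⇒upper-neg (negative x<0) = positive (ℤP.neg-mono-< x<0)

upper-·ᵥ : ∀ {s a} → 0ℤ ℤ.< s → Upper a → Upper (s ·ᵥ a)
upper-·ᵥ 0<s (above 0<y) = above (*-pos 0<s 0<y)
upper-·ᵥ {s} {x , _} 0<s (positive 0<x) = subst (λ y → Upper (s * x , y)) (sym (ℤP.*-zeroʳ s)) (positive (*-pos 0<s 0<x))

lower-·ᵥ : ∀ {s a} → 0ℤ ℤ.< s → Lower a → Lower (s ·ᵥ a)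
lower-·ᵥ 0<s (below y<0) = below (*-pos-neg 0<s y<0)
lower-·ᵥ {s} {x , _} 0<s (negative x<0) = subst (λ y → Lower (s * x , y)) (sym (ℤP.*-zeroʳ s)) (negative (*-pos-neg 0<s x<0))

upper⇒0≤y : ∀ {x y} → Upper (x , y) → 0ℤ ℤ.≤ y
upper⇒0≤y (above 0<y) = ℤP.<⇒≤ 0<y
upper⇒0≤y (positive _) = ℤP.≤-refl

leftTurn-upper⇒above : ∀ {a x y} → Upper a → Upper (x , y) → LeftTurn a (x , y) → 0ℤ ℤ.< y
leftTurn-upper⇒above _ (above 0<y) _ = 0<y
leftTurn-upper⇒above {a₁ , a₂} {x} ua (positive 0<x) p =
  ⊥-elim (ℤP.<⇒≱ p (subst (ℤ._≤ 0ℤ) (sym (identity a₁ a₂ x))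
    (ℤP.neg-mono-≤ (*-pos-nonNeg 0<x (upper⇒0≤y ua)))))
  where
  identity : ∀ a₁ a₂ x → a₁ * 0ℤ - x * a₂ ≡ - (x * a₂)
  identity = solve-∀

upper-leftTurn-trans : ∀ {a b c} → Upper a → Upper b → Upper c → LeftTurn a b → LeftTurn b c → LeftTurn a c
upper-leftTurn-trans {a₁ , a₂} {b₁ , b₂} {c₁ , c₂} ua ub uc p q =
  *-cancelˡ-pos (leftTurn-upper⇒above ua ub p)
    (subst (0ℤ ℤ.<_) (sym (identity a₁ a₂ b₁ b₂ c₁ c₂))
      (ℤP.+-mono-<-≤ (*-pos p (leftTurn-upper⇒above ub uc q)) (*-pos-nonNeg q (upper⇒0≤y ua))))
  where
  identity : ∀ a₁ a₂ b₁ b₂ c₁ c₂ →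
    b₂ * (a₁ * c₂ - c₁ * a₂) ≡ (a₁ * b₂ - b₁ * a₂) * c₂ + (b₁ * c₂ - c₁ * b₂) * a₂
  identity = solve-∀

lower-leftTurn-trans : ∀ {a b c} → Lower a → Lower b → Lower c → LeftTurn a b → LeftTurn b c → LeftTurn a c
lower-leftTurn-trans {a} {b} {c} la lb lc p q =
  subst (0ℤ ℤ.<_) (cross-neg-neg a c)
    (upper-leftTurn-trans (lower⇒upper-neg la) (lower⇒upper-neg lb) (lower⇒upper-neg lc)
      (subst (0ℤ ℤ.<_) (sym (cross-neg-neg a b)) p) (subst (0ℤ ℤ.<_) (sym (cross-neg-neg b c)) q))

-- a ≺ b : the argument of a, taken in [0, 2π), is smaller than that of b.
infix 4 _≺_
data _≺_ (a b : Point) : Set where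
  upper-lower : Upper a → Lower b → a ≺ b
  upper-upper : Upper a → Upper b → LeftTurn a b → a ≺ b
  lower-lower : Lower a → Lower b → LeftTurn a b → a ≺ b

≺-trans : ∀ {a b c} → a ≺ b → b ≺ c → a ≺ c
≺-trans (upper-lower ua _) (lower-lower _ lc _) = upper-lower ua lc
≺-trans (upper-upper ua _ _) (upper-lower _ lc) = upper-lower ua lc
≺-trans (upper-upper ua ub p) (upper-upper _ uc q) = upper-upper ua uc (upper-leftTurn-trans ua ub uc p q)
≺-trans (lower-lower la lb p) (lower-lower _ lc q) = lower-lower la lc (lower-leftTurn-trans la lb lc p q)
≺-trans (upper-lower _ lb) (upper-lower ub _) = ⊥-elim (upper⇒¬lower ub lb)
≺-trans (upper-lower _ lb) (upper-upper ub _ _) = ⊥-elim (upper⇒¬lower ub lb)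
≺-trans (upper-upper _ ub _) (lower-lower lb _ _) = ⊥-elim (upper⇒¬lower ub lb)
≺-trans (lower-lower _ lb _) (upper-lower ub _) = ⊥-elim (upper⇒¬lower ub lb)
≺-trans (lower-lower _ lb _) (upper-upper ub _ _) = ⊥-elim (upper⇒¬lower ub lb)

≺-·ᵥ : ∀ {s t a b} → 0ℤ ℤ.< s → 0ℤ ℤ.< t → a ≺ b → s ·ᵥ a ≺ t ·ᵥ b
≺-·ᵥ 0<s 0<t (upper-lower ua lb) = upper-lower (upper-·ᵥ 0<s ua) (lower-·ᵥ 0<t lb)
≺-·ᵥ 0<s 0<t (upper-upper ua ub p) = upper-upper (upper-·ᵥ 0<s ua) (upper-·ᵥ 0<t ub) (leftTurn-·ᵥ 0<s 0<t p)
≺-·ᵥ 0<s 0<t (lower-lower la lb p) = lower-lower (lower-·ᵥ 0<s la) (lower-·ᵥ 0<t lb) (leftTurn-·ᵥ 0<s 0<t p)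

≺-halfˡ : ∀ {a b} → a ≺ b → Upper a ⊎ Lower a
≺-halfˡ (upper-lower ua _) = inj₁ ua
≺-halfˡ (upper-upper ua _ _) = inj₁ ua
≺-halfˡ (lower-lower la _ _) = inj₂ la

≺-halfʳ : ∀ {a b} → a ≺ b → Upper b ⊎ Lower b
≺-halfʳ (upper-lower _ lb) = inj₂ lb
≺-halfʳ (upper-upper _ ub _) = inj₁ ub
≺-halfʳ (lower-lower _ lb _) = inj₂ lb

≺-upper⇒leftTurn : ∀ {a b} → Upper b → a ≺ b → LeftTurn a b
≺-upper⇒leftTurn _ (upper-upper _ _ p) = p
≺-upper⇒leftTurn ub (upper-lower _ lb) = ⊥-elim (upper⇒¬lower ub lb)
≺-upper⇒leftTurn ub (lower-lower _ lb _) = ⊥-elim (upper⇒¬lower ub lb)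

upper-≻⇒swap-neg : ∀ {a w} → Upper a → w ≺ a → cross a w ℤ.< 0ℤ
upper-≻⇒swap-neg {a} {w} _ (upper-upper _ _ p) = leftTurn⇒swap-neg {w} {a} p
upper-≻⇒swap-neg ua (upper-lower _ la) = ⊥-elim (upper⇒¬lower ua la)
upper-≻⇒swap-neg ua (lower-lower _ la _) = ⊥-elim (upper⇒¬lower ua la)

lower-≺⇒leftTurn : ∀ {a w} → Lower a → a ≺ w → LeftTurn a w
lower-≺⇒leftTurn _ (lower-lower _ _ p) = p
lower-≺⇒leftTurn la (upper-lower ua _) = ⊥-elim (upper⇒¬lower ua la)
lower-≺⇒leftTurn la (upper-upper ua _ _) = ⊥-elim (upper⇒¬lower ua la)

-- Past a, the left turns from a are exactly the directions before -a; so they form an initial run.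
upper-run : ∀ {a w w′} → Upper a → a ≺ w → w ≺ w′ → LeftTurn a w′ → LeftTurn a w
upper-run {a} {w} {w′} ua a≺w w≺w′ p = from a≺w (≺-trans {b = w′} w≺w′ (to (≺-trans a≺w w≺w′) p))
  where
  to : ∀ {v} → a ≺ v → LeftTurn a v → v ≺ -ᵥ a
  to {v} (upper-lower _ lv) q = lower-lower lv (upper⇒lower-neg ua) (subst (0ℤ ℤ.<_) (sym (cross-negʳ v a)) q)
  to (upper-upper _ uv _) _ = upper-lower uv (upper⇒lower-neg ua)
  to (lower-lower la _ _) _ = ⊥-elim (upper⇒¬lower ua la)
  from : ∀ {v} → a ≺ v → v ≺ -ᵥ a → LeftTurn a v
  from (upper-upper _ _ q) _ = q
  from {v} (upper-lower _ lv) (lower-lower _ _ q) = subst (0ℤ ℤ.<_) (cross-negʳ v a) q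
  from (upper-lower _ lv) (upper-lower uv _) = ⊥-elim (upper⇒¬lower uv lv)
  from (upper-lower _ lv) (upper-upper uv _ _) = ⊥-elim (upper⇒¬lower uv lv)
  from (lower-lower la _ _) _ = ⊥-elim (upper⇒¬lower ua la)

lower-run : ∀ {a w w′} → Lower a → w ≺ w′ → w′ ≺ a → LeftTurn a w′ → LeftTurn a w
lower-run {a} {w} {w′} la w≺w′ w′≺a p = from (≺-trans w≺w′ (to w′≺a p))
  where
  to : ∀ {v} → v ≺ a → LeftTurn a v → v ≺ -ᵥ a
  to {v} (upper-lower uv _) q = upper-upper uv (lower⇒upper-neg la) (subst (0ℤ ℤ.<_) (sym (cross-negʳ v a)) q)
  to {v} (lower-lower _ _ r) q = ⊥-elim (ℤP.<-asym q (leftTurn⇒swap-neg {v} {a} r))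
  to (upper-upper _ ua _) _ = ⊥-elim (upper⇒¬lower ua la)
  from : ∀ {v} → v ≺ -ᵥ a → LeftTurn a v
  from {v} (upper-upper _ _ q) = subst (0ℤ ℤ.<_) (cross-negʳ v a) q
  from (upper-lower _ l) = ⊥-elim (upper⇒¬lower (lower⇒upper-neg la) l)
  from (lower-lower _ l _) = ⊥-elim (upper⇒¬lower (lower⇒upper-neg la) l)

Turn : Point → Point → Set
Turn a b = a ≺ b × LeftTurn a b

-- Partial sums of a cyclic sequence

sumTo : (ℕ → ℤ) → ℕ → ℤ
sumTo c zero = 0ℤ
sumTo c (suc t) = sumTo c t + c t

module _ (c : ℕ → ℤ) where

  private
    S = sumTo c

  sumTo-mono-≤ : ∀ {a b} → a ≤ b → (∀ {k} → a ≤ k → k < b → 0ℤ ℤ.≤ c k) → S a ℤ.≤ S b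
  sumTo-mono-≤ a≤b = go (ℕP.≤⇒≤′ a≤b)
    where
    go : ∀ {a b} → a ≤′ b → (∀ {k} → a ≤ k → k < b → 0ℤ ℤ.≤ c k) → S a ℤ.≤ S b
    go ≤′-refl _ = ℤP.≤-refl
    go {b = suc b} (≤′-step a≤b) h =
      ℤP.≤-trans (go a≤b (λ a≤k k<b → h a≤k (ℕP.m≤n⇒m≤1+n k<b)))
        (ℤP.i≤i+j (S b) (c b) {{ℤ.nonNegative (h (ℕP.≤′⇒≤ a≤b) ℕP.≤-refl)}})

  sumTo-antimono-≤ : ∀ {a b} → a ≤ b → (∀ {k} → a ≤ k → k < b → c k ℤ.≤ 0ℤ) → S b ℤ.≤ S a
  sumTo-antimono-≤ a≤b = go (ℕP.≤⇒≤′ a≤b)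
    where
    go : ∀ {a b} → a ≤′ b → (∀ {k} → a ≤ k → k < b → c k ℤ.≤ 0ℤ) → S b ℤ.≤ S a
    go ≤′-refl _ = ℤP.≤-refl
    go {b = suc b} (≤′-step a≤b) h =
      ℤP.≤-trans
        (subst (S b + c b ℤ.≤_) (ℤP.+-identityʳ (S b)) (ℤP.+-monoʳ-≤ (S b) (h (ℕP.≤′⇒≤ a≤b) ℕP.≤-refl)))
        (go a≤b (λ a≤k k<b → h a≤k (ℕP.m≤n⇒m≤1+n k<b)))

  sumTo-mono-< : ∀ {a b} → a ≤ b → (∀ {k} → a ≤ k → k ≤ b → 0ℤ ℤ.< c k) → S a ℤ.< S (suc b)
  sumTo-mono-< {b = b} a≤b h =
    ℤP.≤-<-trans (sumTo-mono-≤ a≤b (λ a≤k k<b → ℤP.<⇒≤ (h a≤k (ℕP.<⇒≤ k<b))))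
      (subst (ℤ._< S b + c b) (ℤP.+-identityʳ (S b)) (ℤP.+-monoʳ-< (S b) (h a≤b ℕP.≤-refl)))

  sumTo-antimono-< : ∀ {a b} → a ≤ b → (∀ {k} → a ≤ k → k < b → c k ℤ.≤ 0ℤ) → c b ℤ.< 0ℤ →
    S (suc b) ℤ.< S a
  sumTo-antimono-< {b = b} a≤b h c[b]<0 =
    ℤP.<-≤-trans (subst (S b + c b ℤ.<_) (ℤP.+-identityʳ (S b)) (ℤP.+-monoʳ-< (S b) c[b]<0))
      (sumTo-antimono-≤ a≤b h)

-- k ≼[ i ] k′ : going round the cycle from just after i, k is reached no later than k′.
infix 4 _≼[_]_
_≼[_]_ : ℕ → ℕ → ℕ → Set
k ≼[ i ] k′ = (i < k × k ≤ k′) ⊎ (k ≤ k′ × k′ < i) ⊎ (k′ < i × i < k)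

cyclicPred : ℕ → ℕ → ℕ
cyclicPred m zero = m
cyclicPred m (suc i) = i

record RunAt (c : ℕ → ℤ) (m i : ℕ) : Set where
  field
    vanishes : c i ≡ 0ℤ
    negative-before : c (cyclicPred m i) ℤ.< 0ℤ
    run : ∀ {k k′} → k ≤ m → k′ ≤ m → k ≼[ i ] k′ → 0ℤ ℤ.< c k′ → 0ℤ ℤ.< c k

  nonPositive-after : ∀ {k k′} → k ≤ m → k′ ≤ m → k ≼[ i ] k′ → c k ℤ.≤ 0ℤ → c k′ ℤ.≤ 0ℤ
  nonPositive-after k≤m k′≤m k≼k′ c[k]≤0 =
    ℤP.≮⇒≥ (λ 0<c[k′] → ℤP.<⇒≱ (run k≤m k′≤m k≼k′ 0<c[k′]) c[k]≤0)

  sumTo-suc : sumTo c (suc i) ≡ sumTo c i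
  sumTo-suc = trans (cong (_+_ (sumTo c i)) vanishes) (ℤP.+-identityʳ _)

module _ {c : ℕ → ℤ} {m : ℕ} (total : sumTo c (suc m) ≡ 0ℤ) where

  open RunAt
  open ℤP.≤-Reasoning

  -- Either the run after i covers the entries before j, so S grows from i to j, or it does not, and then S
  -- does not increase from j round to i, and strictly decreases at the entry just before i.
  private
    S = sumTo c

    sumTo-after : ∀ {i j} → RunAt c m i → i < j → j < m → S i ℤ.< S (suc j)
    sumTo-after {i} {j} r i<j j<m with 0ℤ ℤ.<? c j
    ... | yes 0<c[j] = begin-strict
      S i        ≡⟨ sumTo-suc r ⟨
      S (suc i)  <⟨ sumTo-mono-< c {suc i} {j} i<j
                      (λ i<k k≤j → run r (ℕP.≤-trans k≤j j≤m) j≤m (inj₁ (i<k , k≤j)) 0<c[j]) ⟩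
      S (suc j)  ∎
      where j≤m = ℕP.<⇒≤ j<m
    sumTo-after {zero} {j} r 0<j j<m | no 0≮c[j] = begin-strict
      S 0        ≡⟨ total ⟨
      S (suc m)  <⟨ sumTo-antimono-< c {suc j} {m} j<m
                      (λ j<k k<m → nonPositive-after r (ℕP.<⇒≤ j<m) (ℕP.<⇒≤ k<m)
                                     (inj₁ (0<j , ℕP.<⇒≤ j<k)) (ℤP.≮⇒≥ 0≮c[j]))
                      (negative-before r) ⟩
      S (suc j)  ∎
    sumTo-after {suc i} {j} r i<j j<m | no 0≮c[j] = begin-strict
      S (suc i)  <⟨ sumTo-antimono-< c {0} {i} z≤n
                      (λ _ k<i → nonPositive-after r (ℕP.<⇒≤ j<m)
                                   (ℕP.<⇒≤ (ℕP.<-trans (ℕP.<-trans (ℕP.m<n⇒m<1+n k<i) i<j) j<m))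
                                   (inj₂ (inj₂ (ℕP.m<n⇒m<1+n k<i , i<j))) (ℤP.≮⇒≥ 0≮c[j]))
                      (negative-before r) ⟩
      S 0        ≡⟨ total ⟨
      S (suc m)  ≤⟨ sumTo-antimono-≤ c {suc j} {suc m} (ℕP.m≤n⇒m≤1+n j<m)
                      (λ j<k k<1+m → nonPositive-after r (ℕP.<⇒≤ j<m) (ℕP.≤-pred k<1+m)
                                       (inj₁ (i<j , ℕP.<⇒≤ j<k)) (ℤP.≮⇒≥ 0≮c[j])) ⟩
      S (suc j)  ∎

    sumTo-wrap : ∀ {i} → RunAt c m (suc i) → suc i < m → S (suc i) ℤ.< S 0
    sumTo-wrap {i} r i<m with 0ℤ ℤ.<? c m
    ... | yes 0<c[m] = begin-strict
      S (suc i)        ≡⟨ sumTo-suc r ⟨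
      S (suc (suc i))  <⟨ sumTo-mono-< c {suc (suc i)} {m} i<m
                            (λ i<k k≤m → run r k≤m ℕP.≤-refl (inj₁ (i<k , k≤m)) 0<c[m]) ⟩
      S (suc m)        ≡⟨ total ⟩
      S 0              ∎
    ... | no 0≮c[m] = sumTo-antimono-< c {0} {i} z≤n
      (λ _ k<i → nonPositive-after r ℕP.≤-refl (ℕP.<⇒≤ (ℕP.<-trans (ℕP.m<n⇒m<1+n k<i) i<m))
                   (inj₂ (inj₂ (ℕP.m<n⇒m<1+n k<i , i<m))) (ℤP.≮⇒≥ 0≮c[m]))
      (negative-before r)

    sumTo-before : ∀ {i j} → RunAt c m (suc i) → suc j < suc i → suc i ≤ m → S (suc i) ℤ.< S (suc j)
    sumTo-before {i} {j} r j<i i≤m with 0ℤ ℤ.<? c j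
    ... | yes 0<c[j] = begin-strict
      S (suc i)        ≡⟨ sumTo-suc r ⟨
      S (suc (suc i))  ≤⟨ sumTo-mono-≤ c {suc (suc i)} {suc m} (s≤s i≤m)
                            (λ i<k k<1+m → ℤP.<⇒≤ (run r (ℕP.≤-pred k<1+m) j≤m (inj₂ (inj₂ (j<1+i , i<k))) 0<c[j])) ⟩
      S (suc m)        ≡⟨ total ⟩
      S 0              <⟨ sumTo-mono-< c {0} {j} z≤n
                            (λ _ k≤j → run r (ℕP.≤-trans k≤j j≤m) j≤m (inj₂ (inj₁ (k≤j , j<1+i))) 0<c[j]) ⟩
      S (suc j)        ∎
      where
      j<1+i = ℕP.<-trans (ℕP.n<1+n j) j<i
      j≤m = ℕP.<⇒≤ (ℕP.<-≤-trans j<1+i i≤m)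
    ... | no 0≮c[j] = sumTo-antimono-< c {suc j} {i} (ℕP.≤-pred j<i)
      (λ 1+j≤k k<i → nonPositive-after r (ℕP.<⇒≤ (ℕP.<-≤-trans (ℕP.<-trans (ℕP.n<1+n j) j<i) i≤m))
                      (ℕP.<⇒≤ (ℕP.<-≤-trans (ℕP.m<n⇒m<1+n k<i) i≤m))
                      (inj₂ (inj₁ (ℕP.<⇒≤ 1+j≤k , ℕP.m<n⇒m<1+n k<i))) (ℤP.≮⇒≥ 0≮c[j]))
      (negative-before r)

  sumTo-minimum : ∀ {i j} → RunAt c m i → i ≤ m → j ≤ m → j ≢ i → j ≢ suc i % suc m → S i ℤ.< S j
  sumTo-minimum {i} {j} r i≤m j≤m j≢i j≢next with ℕP.<-cmp i j
  ... | tri≈ _ i≡j _ = ⊥-elim (j≢i (sym i≡j))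
  sumTo-minimum {i} {suc j} r i≤m j<m j≢i j≢next | tri< i<1+j _ _ = sumTo-after r i<j j<m
    where
    i<j = ℕP.≤∧≢⇒< (ℕP.≤-pred i<1+j)
      (λ i≡j → j≢next (sym (trans (m<n⇒m%n≡m (s≤s (ℕP.<-≤-trans i<1+j j<m))) (cong suc i≡j))))
  sumTo-minimum {suc i} {zero} r i<m _ _ 0≢next | tri> _ _ _ = sumTo-wrap r 1+i<m
    where
    1+i<m = ℕP.≤∧≢⇒< i<m
      (λ i≡m → 0≢next (sym (trans (cong (λ t → suc t % suc m) i≡m) (n%n≡0 (suc m)))))
  sumTo-minimum {suc i} {suc j} r i<m _ _ _ | tri> _ _ j<i = sumTo-before r j<i i<m

-- Convex polygons from sorted edge cycles

sumToᵥ : (ℕ → Point) → ℕ → Point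
sumToᵥ e zero = 0ᵥ
sumToᵥ e (suc t) = sumToᵥ e t +ᵥ e t

cross-sumToᵥ : ∀ a e t → cross a (sumToᵥ e t) ≡ sumTo (λ k → cross a (e k)) t
cross-sumToᵥ a e zero = cross-0ᵥʳ a
cross-sumToᵥ a e (suc t) = trans (cross-+ᵥʳ a (sumToᵥ e t) (e t)) (cong (_+ cross a (e t)) (cross-sumToᵥ a e t))

record SortedEdgeCycle (e : ℕ → Point) (m : ℕ) : Set where
  field
    sorted : ∀ {k k′} → k < k′ → k′ ≤ m → e k ≺ e k′
    turn : ∀ {k} → k < m → LeftTurn (e k) (e (suc k))
    wrap : LeftTurn (e m) (e 0)

module _ {e : ℕ → Point} {m : ℕ} (cycle : SortedEdgeCycle e m) (1≤m : 1 ≤ m) where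

  open SortedEdgeCycle cycle

  private
    half : ∀ {i} → i ≤ m → Upper (e i) ⊎ Lower (e i)
    half {zero} _ = ≺-halfˡ (sorted z<s 1≤m)
    half {suc i} i<m = ≺-halfʳ (sorted ℕP.≤-refl i<m)

    run-from : ∀ a {k k′} → k ≤ k′ → k′ ≤ m →
      (e k ≺ e k′ → LeftTurn a (e k′) → LeftTurn a (e k)) → LeftTurn a (e k′) → LeftTurn a (e k)
    run-from a k≤k′ k′≤m step p with ℕP.m≤n⇒m<n∨m≡n k≤k′
    ... | inj₁ k<k′ = step (sorted k<k′ k′≤m) p
    ... | inj₂ refl = p

  runAt : ∀ {i} → i ≤ m → RunAt (λ k → cross (e i) (e k)) m i
  runAt {i} i≤m = record
    { vanishes = cross-self (e i)
    ; negative-before = negative-before i≤m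
    ; run = run (half i≤m)
    }
    where
    negative-before : ∀ {i} → i ≤ m → cross (e i) (e (cyclicPred m i)) ℤ.< 0ℤ
    negative-before {zero} _ = leftTurn⇒swap-neg {e m} {e 0} wrap
    negative-before {suc i} i<m = leftTurn⇒swap-neg {e i} {e (suc i)} (turn i<m)
    run : Upper (e i) ⊎ Lower (e i) → ∀ {k k′} → k ≤ m → k′ ≤ m → k ≼[ i ] k′ →
      LeftTurn (e i) (e k′) → LeftTurn (e i) (e k)
    run (inj₁ ua) k≤m k′≤m (inj₁ (i<k , k≤k′)) = run-from (e i) k≤k′ k′≤m (upper-run ua (sorted i<k k≤m))
    run (inj₁ ua) _ _ (inj₂ (inj₁ (_ , k′<i))) p = ⊥-elim (ℤP.<-asym p (upper-≻⇒swap-neg ua (sorted k′<i i≤m)))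
    run (inj₁ ua) _ _ (inj₂ (inj₂ (k′<i , _))) p = ⊥-elim (ℤP.<-asym p (upper-≻⇒swap-neg ua (sorted k′<i i≤m)))
    run (inj₂ la) k≤m _ (inj₁ (i<k , _)) _ = lower-≺⇒leftTurn la (sorted i<k k≤m)
    run (inj₂ la) _ k′≤m (inj₂ (inj₁ (k≤k′ , k′<i))) =
      run-from (e i) k≤k′ k′≤m (λ k≺k′ → lower-run la k≺k′ (sorted k′<i i≤m))
    run (inj₂ la) k≤m _ (inj₂ (inj₂ (_ , i<k))) _ = lower-≺⇒leftTurn la (sorted i<k k≤m)

  vertices-left-of-edge : sumToᵥ e (suc m) ≡ 0ᵥ → ∀ {i j} → i ≤ m → j ≤ m → j ≢ i → j ≢ suc i % suc m →
    LeftTurn (e i) (sumToᵥ e j ⊖ sumToᵥ e i)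
  vertices-left-of-edge closed {i} {j} i≤m j≤m j≢i j≢next =
    subst (0ℤ ℤ.<_)
      (sym (trans (cross-⊖ʳ (e i) (sumToᵥ e i) (sumToᵥ e j))
                  (cong₂ _-_ (cross-sumToᵥ (e i) e j) (cross-sumToᵥ (e i) e i))))
      (i<j⇒0<j-i (sumTo-minimum total (runAt i≤m) i≤m j≤m j≢i j≢next))
    where
    total : sumTo (λ k → cross (e i) (e k)) (suc m) ≡ 0ℤ
    total = trans (sym (cross-sumToᵥ (e i) e (suc m))) (trans (cong (cross (e i)) closed) (cross-0ᵥʳ (e i)))

toℕ-next : ∀ {m} (i : Fin (suc m)) → toℕ (next i) ≡ suc (toℕ i) % suc m
toℕ-next i = FinP.toℕ-fromℕ< _

sumToᵥ-edge : ∀ {e m} → sumToᵥ e (suc m) ≡ 0ᵥ → ∀ (i : Fin (suc m)) →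
  sumToᵥ e (toℕ (next i)) ⊖ sumToᵥ e (toℕ i) ≡ e (toℕ i)
sumToᵥ-edge {e} {m} closed i with ℕP.m≤n⇒m<n∨m≡n (ℕP.≤-pred (FinP.toℕ<n i))
... | inj₁ i<m =
  trans (cong from-i (trans (toℕ-next i) (m<n⇒m%n≡m (s≤s i<m)))) (+ᵥ-⊖-cancel (sumToᵥ e (toℕ i)) (e (toℕ i)))
  where
  from-i = λ t → sumToᵥ e t ⊖ sumToᵥ e (toℕ i)
... | inj₂ i≡m =
  trans (cong from-i next≡0) (+ᵥ≡0ᵥ⇒0ᵥ⊖ {sumToᵥ e (toℕ i)} (subst (λ t → sumToᵥ e (suc t) ≡ 0ᵥ) (sym i≡m) closed))
  where
  from-i = λ t → sumToᵥ e t ⊖ sumToᵥ e (toℕ i)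
  next≡0 = trans (toℕ-next i) (trans (cong (λ t → suc t % suc m) i≡m) (n%n≡0 (suc m)))

sortedEdgeCycle⇒convex : ∀ {e m} → SortedEdgeCycle e m → 2 ≤ m → sumToᵥ e (suc m) ≡ 0ᵥ →
  ConvexPolygon {suc m} (λ j → sumToᵥ e (toℕ j))
sortedEdgeCycle⇒convex {e} {m} cycle 2≤m closed = s≤s 2≤m , inj₁ left
  where
  left : ∀ i j → j ≢ i → j ≢ next i →
    LeftTurn (sumToᵥ e (toℕ (next i)) ⊖ sumToᵥ e (toℕ i)) (sumToᵥ e (toℕ j) ⊖ sumToᵥ e (toℕ i))
  left i j j≢i j≢next =
    subst (λ d → LeftTurn d (sumToᵥ e (toℕ j) ⊖ sumToᵥ e (toℕ i))) (sym (sumToᵥ-edge closed i))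
      (vertices-left-of-edge cycle (ℕP.≤-trans (s≤s z≤n) 2≤m) closed
        (ℕP.≤-pred (FinP.toℕ<n i)) (ℕP.≤-pred (FinP.toℕ<n j))
        (λ eq → j≢i (FinP.toℕ-injective eq))
        (λ eq → j≢next (FinP.toℕ-injective (trans eq (sym (toℕ-next i))))))

infixl 9 _!_
_!_ : List Point → ℕ → Point
[] ! _ = 0ᵥ
(x ∷ xs) ! zero = x
(x ∷ xs) ! suc k = xs ! k

sumᵥ : List Point → Point
sumᵥ = foldr _+ᵥ_ 0ᵥ

sumToᵥ-∷ : ∀ x xs t → sumToᵥ ((x ∷ xs) !_) (suc t) ≡ x +ᵥ sumToᵥ (xs !_) t
sumToᵥ-∷ x xs zero = +ᵥ-comm 0ᵥ x
sumToᵥ-∷ x xs (suc t) = trans (cong (_+ᵥ xs ! t) (sumToᵥ-∷ x xs t)) (+ᵥ-assoc x (sumToᵥ (xs !_) t) (xs ! t))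

sumToᵥ-! : ∀ xs → sumToᵥ (xs !_) (length xs) ≡ sumᵥ xs
sumToᵥ-! [] = refl
sumToᵥ-! (x ∷ xs) = trans (sumToᵥ-∷ x xs (length xs)) (cong (x +ᵥ_) (sumToᵥ-! xs))

sumᵥ-++ : ∀ xs ys → sumᵥ (xs ++ ys) ≡ sumᵥ xs +ᵥ sumᵥ ys
sumᵥ-++ [] ys = cong₂ _,_ (sym (ℤP.+-identityˡ _)) (sym (ℤP.+-identityˡ _))
sumᵥ-++ (x ∷ xs) ys = trans (cong (x +ᵥ_) (sumᵥ-++ xs ys)) (sym (+ᵥ-assoc x (sumᵥ xs) (sumᵥ ys)))

sumᵥ-·ᵥ : ∀ s xs → sumᵥ (map (s ·ᵥ_) xs) ≡ s ·ᵥ sumᵥ xs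
sumᵥ-·ᵥ s [] = cong₂ _,_ (sym (ℤP.*-zeroʳ s)) (sym (ℤP.*-zeroʳ s))
sumᵥ-·ᵥ s ((x₁ , x₂) ∷ xs) = trans (cong (s ·ᵥ (x₁ , x₂) +ᵥ_) (sumᵥ-·ᵥ s xs))
  (cong₂ _,_ (sym (ℤP.*-distribˡ-+ s x₁ _)) (sym (ℤP.*-distribˡ-+ s x₂ _)))

sumᵥ-neg : ∀ xs → sumᵥ (map -ᵥ_ xs) ≡ -ᵥ sumᵥ xs
sumᵥ-neg [] = refl
sumᵥ-neg ((x₁ , x₂) ∷ xs) = trans (cong (-ᵥ (x₁ , x₂) +ᵥ_) (sumᵥ-neg xs))
  (cong₂ _,_ (sym (ℤP.neg-distrib-+ x₁ _)) (sym (ℤP.neg-distrib-+ x₂ _)))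

All-! : ∀ {P : Point → Set} {xs} → All P xs → ∀ {k} → k < length xs → P (xs ! k)
All-! (p ∷ _) {zero} _ = p
All-! (_ ∷ ps) {suc k} (s≤s k<) = All-! ps k<

linked-! : ∀ {R : Point → Point → Set} → Transitive R → ∀ {xs} → Linked R xs →
  ∀ {k k′} → k < k′ → k′ < length xs → R (xs ! k) (xs ! k′)
linked-! trans (r ∷ _) {zero} {suc zero} _ _ = r
linked-! trans (r ∷ rs) {zero} {suc (suc k′)} _ (s≤s k′<) = trans r (linked-! trans rs {zero} {suc k′} z<s k′<)
linked-! trans (_ ∷ rs) {suc k} {suc k′} (s≤s k<k′) (s≤s k′<) = linked-! trans rs k<k′ k′<
linked-! trans [-] {_} {suc _} _ (s≤s ())

linked-!-suc : ∀ {R : Point → Point → Set} {xs} → Linked R xs → ∀ {k} → suc k < length xs → R (xs ! k) (xs ! suc k)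
linked-!-suc (r ∷ _) {zero} _ = r
linked-!-suc (_ ∷ rs) {suc k} (s≤s k<) = linked-!-suc rs k<
linked-!-suc [-] (s≤s ())

last-! : ∀ x xs → last (x ∷ xs) ≡ just ((x ∷ xs) ! length xs)
last-! x [] = refl
last-! x (y ∷ ys) = last-! y ys

linked⇒sortedEdgeCycle : ∀ {xs} → 0 < length xs → Linked Turn xs → Connected LeftTurn (last xs) (head xs) →
  SortedEdgeCycle (xs !_) (ℕ.pred (length xs))
linked⇒sortedEdgeCycle {x ∷ xs} _ turns wrap = record
  { sorted = λ k<k′ k′≤m → linked-! ≺-trans (Linked.map proj₁ turns) k<k′ (s≤s k′≤m)
  ; turn = λ k<m → proj₂ (linked-!-suc turns (s≤s k<m))
  ; wrap = drop-just (subst (λ l → Connected LeftTurn l (just x)) (last-! x xs) wrap)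
  }

PositiveMultiple : Point → Point → Set
PositiveMultiple a b = ∃ λ s → 0ℤ ℤ.< s × a ≡ s ·ᵥ b

positiveMultiple-·ᵥ : ∀ {s a b} → 0ℤ ℤ.< s → PositiveMultiple a b → PositiveMultiple (s ·ᵥ a) b
positiveMultiple-·ᵥ {s} {b = b} 0<s (t , 0<t , refl) = s * t , *-pos 0<s 0<t , ·ᵥ-assoc s t b

positiveMultiple-neg : ∀ {a b} → PositiveMultiple a b → PositiveMultiple (-ᵥ a) (-ᵥ b)
positiveMultiple-neg {b = b} (t , 0<t , refl) = t , 0<t , neg-·ᵥ t b

positiveMultiples-·ᵥ : ∀ {s xs ys} → 0ℤ ℤ.< s → Pointwise PositiveMultiple xs ys →
  Pointwise PositiveMultiple (map (s ·ᵥ_) xs) ys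
positiveMultiples-·ᵥ 0<s [] = []
positiveMultiples-·ᵥ 0<s (m ∷ ms) = positiveMultiple-·ᵥ 0<s m ∷ positiveMultiples-·ᵥ 0<s ms

positiveMultiples-refl : ∀ xs → Pointwise PositiveMultiple xs xs
positiveMultiples-refl [] = []
positiveMultiples-refl ((x₁ , x₂) ∷ xs) =
  (+ 1 , +<+ z<s , sym (cong₂ _,_ (ℤP.*-identityˡ x₁) (ℤP.*-identityˡ x₂))) ∷ positiveMultiples-refl xs

pointwise-! : ∀ {R : Point → Point → Set} {xs ys} → Pointwise R xs ys → ∀ {k} → k < length ys → R (xs ! k) (ys ! k)
pointwise-! (r ∷ _) {zero} _ = r
pointwise-! (_ ∷ rs) {suc k} (s≤s k<) = pointwise-! rs k<

sortedEdgeCycle-rescale : ∀ {xs ys} → Pointwise PositiveMultiple xs ys →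
  SortedEdgeCycle (ys !_) (ℕ.pred (length ys)) → SortedEdgeCycle (xs !_) (ℕ.pred (length xs))
sortedEdgeCycle-rescale [] cycle = cycle
sortedEdgeCycle-rescale {xs@(_ ∷ xs′)} {ys@(_ ∷ _)} rs@(_ ∷ rs′) cycle = record
  { sorted = λ k<k′ k′≤m →
      rescaled _≺_ ≺-·ᵥ (sorted k<k′ (m≡ k′≤m)) (pm (ℕP.<⇒≤ (ℕP.<-≤-trans k<k′ k′≤m))) (pm k′≤m)
  ; turn = λ k<m → rescaled LeftTurn leftTurn-·ᵥ (turn (m≡ k<m)) (pm (ℕP.<⇒≤ k<m)) (pm k<m)
  ; wrap = rescaled LeftTurn leftTurn-·ᵥ (subst (λ m → LeftTurn (ys ! m) (ys ! 0)) (sym (Pointwise-length rs′)) wrap)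
      (pm ℕP.≤-refl) (pm z≤n)
  }
  where
  open SortedEdgeCycle cycle
  m≡ : ∀ {k} → k ≤ length xs′ → k ≤ ℕ.pred (length ys)
  m≡ = subst (_ ≤_) (Pointwise-length rs′)
  pm : ∀ {k} → k ≤ ℕ.pred (length xs) → PositiveMultiple (xs ! k) (ys ! k)
  pm k≤ = pointwise-! rs (s≤s (subst (_ ≤_) (Pointwise-length rs′) k≤))
  rescaled : ∀ (R : Point → Point → Set) → (∀ {s t a b} → 0ℤ ℤ.< s → 0ℤ ℤ.< t → R a b → R (s ·ᵥ a) (t ·ᵥ b)) →
    ∀ {a b a′ b′} → R a b → PositiveMultiple a′ a → PositiveMultiple b′ b → R a′ b′
  rescaled R R-·ᵥ r (s , 0<s , refl) (t , 0<t , refl) = R-·ᵥ 0<s 0<t r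

-- The rectangular lattice ℤ × √ν ℤ and the pair vectors γ

normν : ℕ → Point → ℤ
normν ν (x , y) = x * x + + ν * (y * y)

normν-·ᵥ : ∀ ν s x → normν ν (s ·ᵥ x) ≡ (s * s) * normν ν x
normν-·ᵥ ν s (x₁ , x₂) = identity (+ ν) s x₁ x₂
  where
  identity : ∀ ν s x₁ x₂ → (s * x₁) * (s * x₁) + ν * ((s * x₂) * (s * x₂)) ≡ (s * s) * (x₁ * x₁ + ν * (x₂ * x₂))
  identity = solve-∀

normν-neg : ∀ ν x → normν ν (-ᵥ x) ≡ normν ν x
normν-neg ν (x₁ , x₂) = identity (+ ν) x₁ x₂
  where
  identity : ∀ ν x₁ x₂ → (- x₁) * (- x₁) + ν * ((- x₂) * (- x₂)) ≡ x₁ * x₁ + ν * (x₂ * x₂)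
  identity = solve-∀

rectangular : (ν : ℕ) → .{{ℕ.NonZero ν}} → IntegralLattice
rectangular (suc ν) = gram (+ 1) 0ℤ (+ suc ν) (+<+ z<s) (+<+ z<s)

normSq-rectangular : ∀ ν .{{_ : ℕ.NonZero ν}} p → normSq (rectangular ν) p ≡ normν ν p
normSq-rectangular (suc ν) (x , y) = identity (+ suc ν) x y
  where
  identity : ∀ ν x y → + 1 * (x * x) + + 2 * (0ℤ * (x * y)) + ν * (y * y) ≡ x * x + ν * (y * y)
  identity = solve-∀

edgeCycle⇒convexEquilateral : ∀ {ν} .{{_ : ℕ.NonZero ν}} {T} es → 3 ≤ length es →
  SortedEdgeCycle (es !_) (ℕ.pred (length es)) → sumᵥ es ≡ 0ᵥ → All (λ e → normν ν e ≡ T) es →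
  ContainsConvexEquilateral (rectangular ν) (length es)
edgeCycle⇒convexEquilateral {ν} {T} es@(_ ∷ _) (s≤s 2≤m) cycle closed norms =
  vertex , sortedEdgeCycle⇒convex cycle 2≤m closed′ , λ i j → trans (edge-norm i) (sym (edge-norm j))
  where
  vertex = λ j → sumToᵥ (es !_) (toℕ j)
  closed′ = trans (sumToᵥ-! es) closed
  edge-norm : ∀ i → normSq (rectangular ν) (vertex (next i) ⊖ vertex i) ≡ T
  edge-norm i = trans (cong (normSq (rectangular ν)) (sumToᵥ-edge closed′ i))
    (trans (normSq-rectangular ν (es ! toℕ i)) (All-! norms (FinP.toℕ<n i)))

-- γ ν m is (m + √-ν)² in the basis (1 , √-ν), so multiplicativity of the norm gives normν-γ.
γ : ℕ → ℕ → Point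
γ ν m = + m * + m - + ν , + 2 * + m

pairLength : ℕ → ℕ → ℤ
pairLength ν m = + m * + m + + ν

normν-γ : ∀ ν m → normν ν (γ ν m) ≡ pairLength ν m * pairLength ν m
normν-γ ν m = identity (+ m) (+ ν)
  where
  identity : ∀ m ν → (m * m - ν) * (m * m - ν) + ν * ((+ 2 * m) * (+ 2 * m)) ≡ (m * m + ν) * (m * m + ν)
  identity = solve-∀

pairLength-pos : ∀ ν {m} → 1 ≤ m → 0ℤ ℤ.< pairLength ν m
pairLength-pos ν {suc m} _ = +<+ z<s

γ-upper : ∀ ν {m} → 1 ≤ m → Upper (γ ν m)
γ-upper ν {suc m} _ = above (+<+ z<s)

γ-leftTurn : ∀ ν {m} → 1 ≤ m → LeftTurn (γ ν (suc m)) (γ ν m)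
γ-leftTurn ν {suc m} _ = subst (0ℤ ℤ.<_) (sym (identity (+ suc m) (+ ν))) (+<+ z<s)
  where
  identity : ∀ m ν →
    ((+ 1 + m) * (+ 1 + m) - ν) * (+ 2 * m) - (m * m - ν) * (+ 2 * (+ 1 + m)) ≡ + 2 * (m * (+ 1 + m) + ν)
  identity = solve-∀

γ-turn : ∀ ν {m} → 1 ≤ m → Turn (γ ν (suc m)) (γ ν m)
γ-turn ν 1≤m = upper-upper (γ-upper ν z<s) (γ-upper ν 1≤m) (γ-leftTurn ν 1≤m) , γ-leftTurn ν 1≤m

-γ-turn : ∀ ν {m} → 1 ≤ m → Turn (-ᵥ γ ν (suc m)) (-ᵥ γ ν m)
-γ-turn ν {m} 1≤m = lower-lower (upper⇒lower-neg (γ-upper ν z<s)) (upper⇒lower-neg (γ-upper ν 1≤m)) p , p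
  where
  p = subst (0ℤ ℤ.<_) (sym (cross-neg-neg (γ ν (suc m)) (γ ν m))) (γ-leftTurn ν 1≤m)

upper? : ∀ p → Dec (Upper p)
upper? (_ , +[1+ _ ]) = yes (above (+<+ z<s))
upper? (x , + zero) = map′ positive (λ { (positive 0<x) → 0<x ; (above (+<+ ())) }) (0ℤ ℤ.<? x)
upper? (_ , -[1+ _ ]) = no (λ { (above ()) })

lower? : ∀ p → Dec (Lower p)
lower? (_ , -[1+ _ ]) = yes (below -<+)
lower? (x , + zero) = map′ negative (λ { (negative x<0) → x<0 ; (below (+<+ ())) }) (x ℤ.<? 0ℤ)
lower? (_ , +[1+ _ ]) = no (λ { (below (+<+ ())) })

leftTurn? : ∀ a b → Dec (LeftTurn a b)
leftTurn? a b = 0ℤ ℤ.<? cross a b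

≺? : ∀ a b → Dec (a ≺ b)
≺? a b = map′ from to
  ((upper? a ×-dec lower? b) ⊎-dec (upper? a ×-dec upper? b ×-dec leftTurn? a b) ⊎-dec
   (lower? a ×-dec lower? b ×-dec leftTurn? a b))
  where
  from : _ → a ≺ b
  from (inj₁ (ua , lb)) = upper-lower ua lb
  from (inj₂ (inj₁ (ua , ub , p))) = upper-upper ua ub p
  from (inj₂ (inj₂ (la , lb , p))) = lower-lower la lb p
  to : a ≺ b → _
  to (upper-lower ua lb) = inj₁ (ua , lb)
  to (upper-upper ua ub p) = inj₂ (inj₁ (ua , ub , p))
  to (lower-lower la lb p) = inj₂ (inj₂ (la , lb , p))

turn? : ∀ a b → Dec (Turn a b)
turn? a b = ≺? a b ×-dec leftTurn? a b

record SeedData : Set where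
  constructor seed
  field
    K R : ℕ
    u₀ : Point
    us : List Point
    l₀ : Point
    ls : List Point

  size : ℕ
  size = length (u₀ ∷ us) ℕ.+ length (l₀ ∷ ls)

-- A convex polygon with the upper edges u₀ ∷ us followed by the lower edges l₀ ∷ ls, all of norm R², such that
-- the pairs ± γ ν m, m ≥ K, can be inserted in front of u₀ and in front of l₀.
record IsSeed (ν : ℕ) (d : SeedData) : Set where
  open SeedData d
  field
    1≤K : 1 ≤ K
    0<R : 0 < R
    upper : All Upper (u₀ ∷ us)
    lower : All Lower (l₀ ∷ ls)
    upper-turns : Linked Turn (u₀ ∷ us)
    lower-turns : Linked Turn (l₀ ∷ ls)
    upper-to-lower : Connected LeftTurn (last (u₀ ∷ us)) (just l₀)
    lower-to-upper : Connected LeftTurn (last (l₀ ∷ ls)) (just u₀)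
    γ≺u₀ : γ ν K ≺ u₀
    -γ≺l₀ : -ᵥ γ ν K ≺ l₀
    closed : sumᵥ (u₀ ∷ us) +ᵥ sumᵥ (l₀ ∷ ls) ≡ 0ᵥ
    upper-norms : All (λ e → normν ν e ≡ + R * + R) (u₀ ∷ us)
    lower-norms : All (λ e → normν ν e ≡ + R * + R) (l₀ ∷ ls)

isSeed? : ∀ ν d → Dec (IsSeed ν d)
isSeed? ν d = map′ from to
  (1 ℕ.≤? K ×-dec 0 ℕ.<? R ×-dec all? upper? (u₀ ∷ us) ×-dec all? lower? (l₀ ∷ ls) ×-dec
   linked? turn? (u₀ ∷ us) ×-dec linked? turn? (l₀ ∷ ls) ×-dec
   connected? leftTurn? (last (u₀ ∷ us)) (just l₀) ×-dec connected? leftTurn? (last (l₀ ∷ ls)) (just u₀) ×-dec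
   ≺? (γ ν K) u₀ ×-dec ≺? (-ᵥ γ ν K) l₀ ×-dec
   ≡-dec ℤP._≟_ ℤP._≟_ (sumᵥ (u₀ ∷ us) +ᵥ sumᵥ (l₀ ∷ ls)) 0ᵥ ×-dec
   all? (λ e → normν ν e ℤP.≟ + R * + R) (u₀ ∷ us) ×-dec all? (λ e → normν ν e ℤP.≟ + R * + R) (l₀ ∷ ls))
  where
  open SeedData d
  from : _ → IsSeed ν d
  from (a , b , c , d , e , f , g , h , i , j , k , l , m) = record
    { 1≤K = a ; 0<R = b ; upper = c ; lower = d ; upper-turns = e ; lower-turns = f
    ; upper-to-lower = g ; lower-to-upper = h ; γ≺u₀ = i ; -γ≺l₀ = j ; closed = k
    ; upper-norms = l ; lower-norms = m }
  to : IsSeed ν d → _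
  to s = 1≤K , 0<R , upper , lower , upper-turns , lower-turns , upper-to-lower , lower-to-upper ,
         γ≺u₀ , -γ≺l₀ , closed , upper-norms , lower-norms
    where open IsSeed s

-- Inserting pairs into a seed

last-++ : ∀ {A : Set} (xs : List A) {y ys} → last (xs ++ y ∷ ys) ≡ last (y ∷ ys)
last-++ [] = refl
last-++ (x ∷ []) = refl
last-++ (x ∷ x′ ∷ xs) = last-++ (x′ ∷ xs)

last-applyDownFrom : ∀ {A : Set} (f : ℕ → A) r → last (applyDownFrom f (suc r)) ≡ just (f 0)
last-applyDownFrom f zero = refl
last-applyDownFrom f (suc r) = last-applyDownFrom f r

module InsertPairs {ν : ℕ} {d : SeedData} (isSeed : IsSeed ν d) where

  open SeedData d
  open IsSeed isSeed

  private
    1≤t+K : ∀ t → 1 ≤ t ℕ.+ K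
    1≤t+K t = ℕP.≤-trans 1≤K (ℕP.m≤n+m K t)

    lastU lastL : Point
    lastU = (u₀ ∷ us) ! length us
    lastL = (l₀ ∷ ls) ! length ls

    γ≺ : ∀ t {w} → γ ν K ≺ w → γ ν (t ℕ.+ K) ≺ w
    γ≺ zero γ≺w = γ≺w
    γ≺ (suc t) γ≺w = ≺-trans (proj₁ (γ-turn ν (1≤t+K t))) (γ≺ t γ≺w)

    -γ≺ : ∀ t {w} → -ᵥ γ ν K ≺ w → -ᵥ γ ν (t ℕ.+ K) ≺ w
    -γ≺ zero -γ≺w = -γ≺w
    -γ≺ (suc t) -γ≺w = ≺-trans (proj₁ (-γ-turn ν (1≤t+K t))) (-γ≺ t -γ≺w)

    γ≺lastU : γ ν K ≺ lastU
    γ≺lastU = All-! (Linked.Linked⇒All ≺-trans γ≺u₀ (Linked.map proj₁ upper-turns)) (ℕP.n<1+n _)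

    -γ≺lastL : -ᵥ γ ν K ≺ lastL
    -γ≺lastL = All-! (Linked.Linked⇒All ≺-trans -γ≺l₀ (Linked.map proj₁ lower-turns)) (ℕP.n<1+n _)

    upper-lastU : Upper lastU
    upper-lastU = All-! upper (ℕP.n<1+n _)

  Γ : ℕ → List Point
  Γ = applyDownFrom (λ t → γ ν (t ℕ.+ K))

  edges : ℕ → List Point
  edges r = Γ r ++ (u₀ ∷ us) ++ map -ᵥ_ (Γ r) ++ (l₀ ∷ ls)

  length-edges : ∀ r → length (edges r) ≡ size ℕ.+ 2 ℕ.* r
  length-edges r = begin
    length (edges r)
      ≡⟨ List.length-++ (Γ r) ⟩
    length (Γ r) ℕ.+ length ((u₀ ∷ us) ++ map -ᵥ_ (Γ r) ++ l₀ ∷ ls)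
      ≡⟨ cong₂ ℕ._+_ (List.length-applyDownFrom _ r) (List.length-++ (u₀ ∷ us)) ⟩
    r ℕ.+ (length (u₀ ∷ us) ℕ.+ length (map -ᵥ_ (Γ r) ++ l₀ ∷ ls))
      ≡⟨ cong (λ n → r ℕ.+ (length (u₀ ∷ us) ℕ.+ n)) (List.length-++ (map -ᵥ_ (Γ r))) ⟩
    r ℕ.+ (length (u₀ ∷ us) ℕ.+ (length (map -ᵥ_ (Γ r)) ℕ.+ length (l₀ ∷ ls)))
      ≡⟨ cong (λ n → r ℕ.+ (length (u₀ ∷ us) ℕ.+ (n ℕ.+ length (l₀ ∷ ls))))
              (trans (List.length-map -ᵥ_ (Γ r)) (List.length-applyDownFrom _ r)) ⟩
    r ℕ.+ (length (u₀ ∷ us) ℕ.+ (r ℕ.+ length (l₀ ∷ ls)))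
      ≡⟨ identity r (length (u₀ ∷ us)) (length (l₀ ∷ ls)) ⟩
    size ℕ.+ 2 ℕ.* r ∎
    where
    open ≡-Reasoning
    identity : ∀ r a b → r ℕ.+ (a ℕ.+ (r ℕ.+ b)) ≡ a ℕ.+ b ℕ.+ 2 ℕ.* r
    identity = ℕ-Solver.solve-∀

  edges-turns : ∀ r → Linked Turn (edges r)
  edges-turns r =
    Linked.++⁺ (Linked.applyDownFrom⁺₂ _ r (λ t → γ-turn ν (1≤t+K t))) (Γ→U r)
      (Linked.++⁺ upper-turns (U→ r)
        (Linked.++⁺ (Linked.map⁺ (Linked.applyDownFrom⁺₂ _ r (λ t → -γ-turn ν (1≤t+K t)))) (-Γ→L r) lower-turns))
    where
    Γ→U : ∀ r → Connected Turn (last (Γ r)) (just u₀)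
    Γ→U zero = nothing-just
    Γ→U (suc r) = subst (λ l → Connected Turn l (just u₀)) (sym (last-applyDownFrom _ r))
      (just (γ≺u₀ , ≺-upper⇒leftTurn (All.head upper) γ≺u₀))
    fromLastU : ∀ {y} → Turn lastU y → Connected Turn (last (u₀ ∷ us)) (just y)
    fromLastU {y} t = subst (λ l → Connected Turn l (just y)) (sym (last-! u₀ us)) (just t)
    U→ : ∀ r → Connected Turn (last (u₀ ∷ us)) (head (map -ᵥ_ (Γ r) ++ l₀ ∷ ls))
    U→ zero = fromLastU (upper-lower upper-lastU (All.head lower) ,
      drop-just (subst (λ l → Connected LeftTurn l (just l₀)) (last-! u₀ us) upper-to-lower))
    U→ (suc r) = fromLastU (upper-lower upper-lastU (upper⇒lower-neg (γ-upper ν (1≤t+K r))) ,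
      subst (0ℤ ℤ.<_) (sym (cross-negʳ lastU (γ ν (r ℕ.+ K)))) (≺-upper⇒leftTurn upper-lastU (γ≺ r γ≺lastU)))
    -Γ→L : ∀ r → Connected Turn (last (map -ᵥ_ (Γ r))) (just l₀)
    -Γ→L zero = nothing-just
    -Γ→L (suc r) = subst (λ l → Connected Turn l (just l₀))
      (sym (trans (List.last-map -ᵥ_ (Γ (suc r))) (cong (Maybe.map -ᵥ_) (last-applyDownFrom _ r))))
      (just (-γ≺l₀ , lower-≺⇒leftTurn (upper⇒lower-neg (γ-upper ν 1≤K)) -γ≺l₀))

  edges-wrap : ∀ r → Connected LeftTurn (last (edges r)) (head (edges r))
  edges-wrap r = subst (λ l → Connected LeftTurn l (head (edges r))) (sym last≡) (wrap r)
    where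
    open ≡-Reasoning
    last≡ : last (edges r) ≡ just lastL
    last≡ = begin
      last (edges r)                                          ≡⟨ cong last reassociate ⟨
      last ((Γ r ++ (u₀ ∷ us) ++ map -ᵥ_ (Γ r)) ++ l₀ ∷ ls)   ≡⟨ last-++ (Γ r ++ (u₀ ∷ us) ++ map -ᵥ_ (Γ r)) ⟩
      last (l₀ ∷ ls)                                          ≡⟨ last-! l₀ ls ⟩
      just lastL                                              ∎
      where
      reassociate : (Γ r ++ (u₀ ∷ us) ++ map -ᵥ_ (Γ r)) ++ l₀ ∷ ls ≡ edges r
      reassociate = trans (List.++-assoc (Γ r) _ (l₀ ∷ ls)) (cong (Γ r ++_) (List.++-assoc (u₀ ∷ us) _ (l₀ ∷ ls)))
    wrap : ∀ r → Connected LeftTurn (just lastL) (head (edges r))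
    wrap zero = subst (λ l → Connected LeftTurn l (just u₀)) (last-! l₀ ls) lower-to-upper
    wrap (suc r) = just (subst (0ℤ ℤ.<_) (cross-negˡ (γ ν (r ℕ.+ K)) lastL)
      (lower-≺⇒leftTurn (upper⇒lower-neg (γ-upper ν (1≤t+K r))) (-γ≺ r -γ≺lastL)))

  Λ : ℕ → ℤ
  Λ zero = + 1
  Λ (suc r) = Λ r * pairLength ν (r ℕ.+ K)

  Λ-pos : ∀ r → 0ℤ ℤ.< Λ r
  Λ-pos zero = +<+ z<s
  Λ-pos (suc r) = *-pos (Λ-pos r) (pairLength-pos ν (1≤t+K r))

  -- Every edge is stretched to the common length R · Λ r: the seed edges have length R and γ ν (t + K) has
  -- length pairLength ν (t + K).
  Γ̂ : ℕ → List Point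
  Γ̂ zero = []
  Γ̂ (suc r) = (+ R * Λ r) ·ᵥ γ ν (r ℕ.+ K) ∷ map (pairLength ν (r ℕ.+ K) ·ᵥ_) (Γ̂ r)

  equilateralEdges : ℕ → List Point
  equilateralEdges r = Γ̂ r ++ map (Λ r ·ᵥ_) (u₀ ∷ us) ++ map -ᵥ_ (Γ̂ r) ++ map (Λ r ·ᵥ_) (l₀ ∷ ls)

  equilateralEdges-multiples : ∀ r → Pointwise PositiveMultiple (equilateralEdges r) (edges r)
  equilateralEdges-multiples r =
    Pointwise.++⁺ (Γ̂-multiples r)
      (Pointwise.++⁺ (positiveMultiples-·ᵥ (Λ-pos r) (positiveMultiples-refl (u₀ ∷ us)))
        (Pointwise.++⁺ (Pointwise.map⁺ -ᵥ_ -ᵥ_ (Pointwise.map positiveMultiple-neg (Γ̂-multiples r)))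
          (positiveMultiples-·ᵥ (Λ-pos r) (positiveMultiples-refl (l₀ ∷ ls)))))
    where
    Γ̂-multiples : ∀ r → Pointwise PositiveMultiple (Γ̂ r) (Γ r)
    Γ̂-multiples zero = []
    Γ̂-multiples (suc r) = (+ R * Λ r , *-pos (+<+ 0<R) (Λ-pos r) , refl) ∷
      positiveMultiples-·ᵥ (pairLength-pos ν (1≤t+K r)) (Γ̂-multiples r)

  equilateralEdges-norms : ∀ r → All (λ e → normν ν e ≡ (+ R * Λ r) * (+ R * Λ r)) (equilateralEdges r)
  equilateralEdges-norms r =
    All.++⁺ (Γ̂-norms r)
      (All.++⁺ (All.map⁺ (All.map seed-norm upper-norms))
        (All.++⁺ (All.map⁺ (All.map (λ {x} n → trans (normν-neg ν x) n) (Γ̂-norms r)))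
          (All.map⁺ (All.map seed-norm lower-norms))))
    where
    seed-norm : ∀ {x} → normν ν x ≡ + R * + R → normν ν (Λ r ·ᵥ x) ≡ (+ R * Λ r) * (+ R * Λ r)
    seed-norm {x} n = trans (normν-·ᵥ ν (Λ r) x) (trans (cong (Λ r * Λ r *_) n) (identity (+ R) (Λ r)))
      where
      identity : ∀ R Λ → (Λ * Λ) * (R * R) ≡ (R * Λ) * (R * Λ)
      identity = solve-∀
    Γ̂-norms : ∀ r → All (λ e → normν ν e ≡ (+ R * Λ r) * (+ R * Λ r)) (Γ̂ r)
    Γ̂-norms zero = []
    Γ̂-norms (suc r) =
      trans (normν-·ᵥ ν (+ R * Λ r) (γ ν (r ℕ.+ K)))
        (trans (cong ((+ R * Λ r) * (+ R * Λ r) *_) (normν-γ ν (r ℕ.+ K))) (head-identity (+ R) (Λ r) ℓ))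
      ∷ All.map⁺ (All.map (λ {x} n → trans (normν-·ᵥ ν ℓ x) (trans (cong (ℓ * ℓ *_) n) (tail-identity (+ R) (Λ r) ℓ)))
          (Γ̂-norms r))
      where
      ℓ = pairLength ν (r ℕ.+ K)
      head-identity : ∀ R Λ ℓ → ((R * Λ) * (R * Λ)) * (ℓ * ℓ) ≡ (R * (Λ * ℓ)) * (R * (Λ * ℓ))
      head-identity = solve-∀
      tail-identity : ∀ R Λ ℓ → (ℓ * ℓ) * ((R * Λ) * (R * Λ)) ≡ (R * (Λ * ℓ)) * (R * (Λ * ℓ))
      tail-identity = solve-∀

  equilateralEdges-closed : ∀ r → sumᵥ (equilateralEdges r) ≡ 0ᵥ
  equilateralEdges-closed r = begin
    sumᵥ (equilateralEdges r)
      ≡⟨ trans (sumᵥ-++ (Γ̂ r) _) (cong (sumᵥ (Γ̂ r) +ᵥ_) (trans (sumᵥ-++ (map (Λ r ·ᵥ_) (u₀ ∷ us)) _)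
           (cong (sumᵥ (map (Λ r ·ᵥ_) (u₀ ∷ us)) +ᵥ_) (sumᵥ-++ (map -ᵥ_ (Γ̂ r)) _)))) ⟩
    sumᵥ (Γ̂ r) +ᵥ (sumᵥ (map (Λ r ·ᵥ_) (u₀ ∷ us)) +ᵥ (sumᵥ (map -ᵥ_ (Γ̂ r)) +ᵥ sumᵥ (map (Λ r ·ᵥ_) (l₀ ∷ ls))))
      ≡⟨ cong₂ (λ u n+l → sumᵥ (Γ̂ r) +ᵥ (u +ᵥ n+l)) (sumᵥ-·ᵥ (Λ r) (u₀ ∷ us))
           (cong₂ _+ᵥ_ (sumᵥ-neg (Γ̂ r)) (sumᵥ-·ᵥ (Λ r) (l₀ ∷ ls))) ⟩
    sumᵥ (Γ̂ r) +ᵥ (Λ r ·ᵥ sumᵥ (u₀ ∷ us) +ᵥ (-ᵥ sumᵥ (Γ̂ r) +ᵥ Λ r ·ᵥ sumᵥ (l₀ ∷ ls)))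
      ≡⟨ pairs-cancel (sumᵥ (Γ̂ r)) (sumᵥ (u₀ ∷ us)) (sumᵥ (l₀ ∷ ls)) (Λ r) ⟩
    Λ r ·ᵥ (sumᵥ (u₀ ∷ us) +ᵥ sumᵥ (l₀ ∷ ls))
      ≡⟨ cong (Λ r ·ᵥ_) closed ⟩
    Λ r ·ᵥ 0ᵥ
      ≡⟨ cong₂ _,_ (ℤP.*-zeroʳ (Λ r)) (ℤP.*-zeroʳ (Λ r)) ⟩
    0ᵥ ∎
    where
    open ≡-Reasoning
    pairs-cancel : ∀ g u l s → g +ᵥ (s ·ᵥ u +ᵥ (-ᵥ g +ᵥ s ·ᵥ l)) ≡ s ·ᵥ (u +ᵥ l)
    pairs-cancel (g₁ , g₂) (u₁ , u₂) (l₁ , l₂) s = cong₂ _,_ (identity g₁ u₁ l₁ s) (identity g₂ u₂ l₂ s)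
      where
      identity : ∀ g u l s → g + (s * u + (- g + s * l)) ≡ s * (u + l)
      identity = solve-∀

  polygons : .{{_ : ℕ.NonZero ν}} → 3 ≤ size → ∀ r → ContainsConvexEquilateral (rectangular ν) (size ℕ.+ 2 ℕ.* r)
  polygons 3≤size r = subst (ContainsConvexEquilateral (rectangular ν)) length≡
    (edgeCycle⇒convexEquilateral (equilateralEdges r) (subst (3 ≤_) (sym length≡) 3≤size+2r)
      (sortedEdgeCycle-rescale (equilateralEdges-multiples r)
        (linked⇒sortedEdgeCycle (subst (0 <_) (sym (length-edges r)) (ℕP.<-≤-trans z<s 3≤size+2r))
          (edges-turns r) (edges-wrap r)))
      (equilateralEdges-closed r) (equilateralEdges-norms r))
    where
    3≤size+2r = ℕP.≤-trans 3≤size (ℕP.m≤m+n size _)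
    length≡ : length (equilateralEdges r) ≡ size ℕ.+ 2 ℕ.* r
    length≡ = trans (Pointwise-length (equilateralEdges-multiples r)) (length-edges r)

even-or-odd : ∀ t → (∃ λ r → t ≡ 2 ℕ.* r) ⊎ (∃ λ r → t ≡ 1 ℕ.+ 2 ℕ.* r)
even-or-odd zero = inj₁ (0 , refl)
even-or-odd (suc t) with even-or-odd t
... | inj₁ (r , t≡2r) = inj₂ (r , cong suc t≡2r)
... | inj₂ (r , t≡1+2r) = inj₁ (suc r , trans (cong suc t≡1+2r) (identity r))
  where
  identity : ∀ r → 2 ℕ.+ 2 ℕ.* r ≡ 2 ℕ.* suc r
  identity = ℕ-Solver.solve-∀

odd-or-even-above : ∀ s n → 3 ℕ.+ 2 ℕ.* s ≤ n →
  (∃ λ r → n ≡ 3 ℕ.+ 2 ℕ.* s ℕ.+ 2 ℕ.* r) ⊎ (∃ λ r → n ≡ 4 ℕ.+ 2 ℕ.* r)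
odd-or-even-above s n q≤n with even-or-odd (n ℕ.∸ (3 ℕ.+ 2 ℕ.* s))
... | inj₁ (r , t≡2r) = inj₁ (r , trans (sym (ℕP.m+[n∸m]≡n q≤n)) (cong (3 ℕ.+ 2 ℕ.* s ℕ.+_) t≡2r))
... | inj₂ (r , t≡1+2r) =
  inj₂ (s ℕ.+ r , trans (sym (ℕP.m+[n∸m]≡n q≤n)) (trans (cong (3 ℕ.+ 2 ℕ.* s ℕ.+_) t≡1+2r) (identity s r)))
  where
  identity : ∀ s r → 3 ℕ.+ 2 ℕ.* s ℕ.+ (1 ℕ.+ 2 ℕ.* r) ≡ 4 ℕ.+ 2 ℕ.* (s ℕ.+ r)
  identity = ℕ-Solver.solve-∀

-- The rhombus with sides (± (ν - 1) , ± 2), of norm (ν - 1)² + 4 ν = (ν + 1)².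
evenSeed : ℕ → SeedData
evenSeed ν = seed (suc ν) (suc ν) (w , + 2) ((- w , + 2) ∷ []) (- w , - + 2) ((w , - + 2) ∷ [])
  where
  w = + ν - + 1

polygons-from-seeds : ∀ {ν s d} .{{_ : ℕ.NonZero ν}} → IsSeed ν d → SeedData.size d ≡ 3 ℕ.+ 2 ℕ.* s →
  IsSeed ν (evenSeed ν) → ∀ n → 3 ℕ.+ 2 ℕ.* s ≤ n → ContainsConvexEquilateral (rectangular ν) n
polygons-from-seeds {ν} {s} {d} odd size≡ even n q≤n with odd-or-even-above s n q≤n
... | inj₁ (r , n≡) = subst (ContainsConvexEquilateral (rectangular ν)) (trans (cong (ℕ._+ 2 ℕ.* r) size≡) (sym n≡))
  (InsertPairs.polygons odd (subst (3 ≤_) (sym size≡) (ℕP.m≤m+n 3 _)) r)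
... | inj₂ (r , n≡) = subst (ContainsConvexEquilateral (rectangular ν)) (sym n≡)
  (InsertPairs.polygons even (s≤s (s≤s (s≤s z≤n))) r)

-- Moving polygons into L

-- In the coordinates of a basis a, b of L with Gram matrix (A B; B C), the map (u , v) ↦ (k u - B v , A v)
-- multiplies cross products by k A and, since A |m a + n b|² = (A m + B n)² + D(L)² n², squared lengths by A k².
module Similarity (L : IntegralLattice) (k : ℕ) where

  φ : Point → Point
  φ (u , v) = + k * u - B L * v , A L * v

  φ-⊖ : ∀ p q → φ p ⊖ φ q ≡ φ (p ⊖ q)
  φ-⊖ (p₁ , p₂) (q₁ , q₂) = cong₂ _,_ (identity₁ (B L) (+ k) p₁ p₂ q₁ q₂) (identity₂ (A L) p₂ q₂)
    where
    identity₁ : ∀ B k p₁ p₂ q₁ q₂ →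
      (k * p₁ - B * p₂) - (k * q₁ - B * q₂) ≡ k * (p₁ - q₁) - B * (p₂ - q₂)
    identity₁ = solve-∀
    identity₂ : ∀ A p₂ q₂ → A * p₂ - A * q₂ ≡ A * (p₂ - q₂)
    identity₂ = solve-∀

  cross-φ : ∀ p q → cross (φ p) (φ q) ≡ (+ k * A L) * cross p q
  cross-φ (p₁ , p₂) (q₁ , q₂) = identity (A L) (B L) (+ k) p₁ p₂ q₁ q₂
    where
    identity : ∀ A B k p₁ p₂ q₁ q₂ →
      (k * p₁ - B * p₂) * (A * q₂) - (k * q₁ - B * q₂) * (A * p₂) ≡ (k * A) * (p₁ * q₂ - q₁ * p₂)
    identity = solve-∀

  normSq-φ : ∀ {ν} .{{_ : ℕ.NonZero ν}} → D² L ≡ + (k ℕ.* k ℕ.* ν) → ∀ w →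
    normSq L (φ w) ≡ (A L * (+ k * + k)) * normSq (rectangular ν) w
  normSq-φ {ν} D²≡ (u , v) = ℤP.*-cancelˡ-≡ (A L) _ _ {{ℤ.>-nonZero (A-pos L)}} (begin
    A L * normSq L (φ (u , v))
      ≡⟨ completeSquare (A L) (B L) (C L) (+ k) u v ⟩
    ((A L * + k) * u) * ((A L * + k) * u) + D² L * ((A L * v) * (A L * v))
      ≡⟨ cong (λ D → ((A L * + k) * u) * ((A L * + k) * u) + D * ((A L * v) * (A L * v)))
              (trans D²≡ (trans (ℤP.pos-* (k ℕ.* k) ν) (cong (_* + ν) (ℤP.pos-* k k)))) ⟩
    ((A L * + k) * u) * ((A L * + k) * u) + (+ k * + k * + ν) * ((A L * v) * (A L * v))
      ≡⟨ regroup (A L) (+ k) (+ ν) u v ⟩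
    A L * ((A L * (+ k * + k)) * normν ν (u , v))
      ≡⟨ cong (λ N → A L * ((A L * (+ k * + k)) * N)) (normSq-rectangular ν (u , v)) ⟨
    A L * ((A L * (+ k * + k)) * normSq (rectangular ν) (u , v)) ∎)
    where
    open ≡-Reasoning
    completeSquare : ∀ A B C k u v →
      A * (A * ((k * u - B * v) * (k * u - B * v)) + + 2 * (B * ((k * u - B * v) * (A * v))) + C * ((A * v) * (A * v)))
        ≡ ((A * k) * u) * ((A * k) * u) + (A * C - B * B) * ((A * v) * (A * v))
    completeSquare = solve-∀
    regroup : ∀ A k ν u v →
      ((A * k) * u) * ((A * k) * u) + (k * k * ν) * ((A * v) * (A * v)) ≡ A * ((A * (k * k)) * (u * u + ν * (v * v)))
    regroup = solve-∀

  transfer : ∀ {ν n} .{{_ : ℕ.NonZero ν}} → 0 < k → D² L ≡ + (k ℕ.* k ℕ.* ν) →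
    ContainsConvexEquilateral (rectangular ν) n → ContainsConvexEquilateral L n
  transfer {ν} 0<k D²≡ (v , (3≤n , convex) , equilateral) =
    (λ j → φ (v j)) , (3≤n , Sum.map left right convex) , equal
    where
    0<kA : 0ℤ ℤ.< + k * A L
    0<kA = *-pos (+<+ 0<k) (A-pos L)
    cross-edge : ∀ i j →
      cross (φ (v (next i)) ⊖ φ (v i)) (φ (v j) ⊖ φ (v i)) ≡ (+ k * A L) * cross (v (next i) ⊖ v i) (v j ⊖ v i)
    cross-edge i j = trans (cong₂ cross (φ-⊖ (v (next i)) (v i)) (φ-⊖ (v j) (v i))) (cross-φ _ _)
    left = λ h i j j≢i j≢next → subst (0ℤ ℤ.<_) (sym (cross-edge i j)) (*-pos 0<kA (h i j j≢i j≢next))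
    right = λ h i j j≢i j≢next → subst (ℤ._< 0ℤ) (sym (cross-edge i j)) (*-pos-neg 0<kA (h i j j≢i j≢next))
    edge-normSq : ∀ i →
      normSq L (φ (v (next i)) ⊖ φ (v i)) ≡ (A L * (+ k * + k)) * normSq (rectangular ν) (v (next i) ⊖ v i)
    edge-normSq i = trans (cong (normSq L) (φ-⊖ (v (next i)) (v i))) (normSq-φ D²≡ _)
    equal : Equilateral L (λ j → φ (v j))
    equal i j = trans (edge-normSq i) (trans (cong (A L * (+ k * + k) *_) (equilateral i j)) (sym (edge-normSq j)))

D²≡k²ν : ∀ L {ν} → Nu L ν → ∃ λ k → 0 < k × D² L ≡ + (k ℕ.* k ℕ.* ν)
D²≡k²ν L (_ , k , ∣D²∣≡) = k , ℕP.n≢0⇒n>0 (λ { refl → ℤP.<-irrefl (sym D²≡) (det-pos L) }) , D²≡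
  where
  D²≡ = trans (sym (ℤP.0≤i⇒+∣i∣≡i (ℤP.<⇒≤ (det-pos L)))) (cong +_ ∣D²∣≡)

-- Squarefree numbers with small prime factors

prime⇒≢1 : ∀ {q} → Prime q → q ≢ 1
prime⇒≢1 q-prime = ℕ.nonTrivial⇒≢1 {{prime⇒nonTrivial q-prime}}

noPrimeFactor⇒≡1 : ∀ {ν} → 0 < ν → (∀ q → Prime q → ¬ q ∣ ν) → ν ≡ 1
noPrimeFactor⇒≡1 {ν} 0<ν none with factorise ν {{ℕ.>-nonZero 0<ν}}
... | record { factors = [] ; isFactorisation = ν≡1 } = ν≡1
... | record { factors = q ∷ qs ; isFactorisation = ν≡ ; factorsPrime = q-prime ∷ _ } =
  ⊥-elim (none q q-prime (subst (q ∣_) (sym ν≡) (m∣m*n (product qs))))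

divisors : List ℕ → List ℕ
divisors [] = 1 ∷ []
divisors (q ∷ qs) = divisors qs ++ map (q ℕ.*_) (divisors qs)

squareFree-∈-divisors : ∀ qs {ν} → SquareFree ν → (∀ p → Prime p → p ∣ ν → p ∈ qs) → ν ∈ divisors qs
squareFree-∈-divisors [] (0<ν , _) factors =
  here (noPrimeFactor⇒≡1 0<ν (λ p p-prime p∣ν → ∉[] (factors p p-prime p∣ν)))
  where
  ∉[] : ∀ {p} → p ∈ [] → ⊥
  ∉[] ()
squareFree-∈-divisors (q ∷ qs) {ν} (0<ν , squareFree) factors with q ∣? ν
... | no q∤ν = ∈-++⁺ˡ (squareFree-∈-divisors qs (0<ν , squareFree) factors′)
  where
  factors′ : ∀ p → Prime p → p ∣ ν → p ∈ qs
  factors′ p p-prime p∣ν with factors p p-prime p∣ν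
  ... | here refl = ⊥-elim (q∤ν p∣ν)
  ... | there p∈qs = p∈qs
... | yes (divides ν′ ν≡ν′q) = ∈-++⁺ʳ (divisors qs) (subst (_∈ map (q ℕ.*_) (divisors qs)) (sym ν≡qν′)
    (∈-map⁺ (q ℕ.*_) (squareFree-∈-divisors qs (0<ν′ , squareFree′) factors′)))
  where
  ν≡qν′ : ν ≡ q ℕ.* ν′
  ν≡qν′ = trans ν≡ν′q (ℕP.*-comm ν′ q)
  ν′∣ν : ν′ ∣ ν
  ν′∣ν = divides q ν≡qν′
  0<ν′ : 0 < ν′
  0<ν′ = ℕP.n≢0⇒n>0 (λ ν′≡0 → ℕP.<-irrefl (sym (trans ν≡ν′q (cong (ℕ._* q) ν′≡0))) 0<ν)
  squareFree′ : ∀ d → d ℕ.* d ∣ ν′ → d ≡ 1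
  squareFree′ d dd∣ν′ = squareFree d (∣-trans dd∣ν′ ν′∣ν)
  factors′ : ∀ p → Prime p → p ∣ ν′ → p ∈ qs
  factors′ p p-prime p∣ν′ with factors p p-prime (∣-trans p∣ν′ ν′∣ν)
  ... | here refl =
    ⊥-elim (prime⇒≢1 p-prime (squareFree p (subst (p ℕ.* p ∣_) (sym ν≡qν′) (*-monoʳ-∣ p p∣ν′))))
  ... | there p∈qs = p∈qs

smallPrimes : List ℕ
smallPrimes = 2 ∷ 3 ∷ 5 ∷ 7 ∷ 11 ∷ 13 ∷ []

prime<17⇒∈smallPrimes : ∀ {q} → q < 17 → Prime q → q ∈ smallPrimes
prime<17⇒∈smallPrimes q<17 =
  subst (λ q → Prime q → q ∈ smallPrimes) (FinP.toℕ-fromℕ< q<17) (check (fromℕ< q<17))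
  where
  check : ∀ (i : Fin 17) → Prime (toℕ i) → toℕ i ∈ smallPrimes
  check = toWitness {a? = FinP.all? (λ i → prime? (toℕ i) →-dec toℕ i ∈? smallPrimes)} tt

-- Entries (ν , s , a seed with 3 + 2 s edges), where 3 + 2 s is the largest prime factor of ν.
seedTable : List (ℕ × ℕ × SeedData)
seedTable =
  ( (3 , 0 , seed 8 26
      (+ 1 , + 15) []
      (- + 23 , - + 7) ((+ 22 , - + 8) ∷ []))
  ∷ (7 , 2 , seed 10 88
      (+ 74 , + 18) ((+ 11 , + 33) ∷ (- + 66 , + 22) ∷ (- + 87 , + 5) ∷ [])
      (- + 24 , - + 32) ((+ 11 , - + 33) ∷ (+ 81 , - + 13) ∷ []))
  ∷ (11 , 4 , seed 23 270
      (+ 237 , + 39) ((+ 171 , + 63) ∷ (+ 50 , + 80) ∷ (- + 27 , + 81) ∷ (- + 225 , + 45) ∷ [])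
      (- + 258 , - + 24) ((- + 225 , - + 45) ∷ (- + 126 , - + 72) ∷ (- + 27 , - + 81) ∷ (+ 171 , - + 63) ∷
                          (+ 259 , - + 23) ∷ []))
  ∷ (15 , 1 , seed 15 3869792
      (+ 3343157 , + 503229) ((+ 2313542 , + 800950) ∷ (- + 3386068 , + 483724) ∷ [])
      (- + 2373923 , - + 789083) ((+ 103292 , - + 998820) ∷ []))
  ∷ (35 , 2 , seed 92 23166
      (+ 22011 , + 1221) ((+ 871 , + 3913) ∷ (- + 21879 , + 1287) ∷ [])
      (- + 22971 , - + 507) ((- + 18414 , - + 2376) ∷ (+ 18161 , - + 2431) ∷ (+ 22221 , - + 1107) ∷ []))
  ∷ (55 , 4 , seed 78 173264
      (+ 115349 , + 17433) ((+ 55454 , + 22134) ∷ (+ 33124 , + 22932) ∷ (- + 96764 , + 19380) ∷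
                            (- + 167076 , + 6188) ∷ [])
      (- + 170079 , - + 4459) ((- + 96951 , - + 19363) ∷ (- + 9996 , - + 23324) ∷ (+ 20111 , - + 23205) ∷
                               (+ 148954 , - + 11934) ∷ (+ 167874 , - + 5782) ∷ []))
  ∷ (39 , 5 , seed 48 8800
      (+ 7370 , + 770) ((+ 4510 , + 1210) ∷ (+ 1780 , + 1380) ∷ (- + 352 , + 1408) ∷ (- + 2185 , + 1365) ∷
                        (- + 8360 , + 440) ∷ [])
      (- + 8503 , - + 363) ((- + 6644 , - + 924) ∷ (- + 4382 , - + 1222) ∷ (- + 586 , - + 1406) ∷
                            (+ 3080 , - + 1320) ∷ (+ 5615 , - + 1085) ∷ (+ 8657 , - + 253) ∷ []))
  ∷ (195 , 5 , seed 418 6421646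
      (+ 6407294 , + 30728) ((+ 5038771 , + 285085) ∷ (+ 4004231 , + 359513) ∷ (+ 3458686 , + 387464) ∷
                             (- + 2073269 , + 435237) ∷ (- + 4721486 , + 311696) ∷ (- + 6356119 , + 65527) ∷ [])
      (- + 6106961 , - + 142191) ((- + 4678729 , - + 314985) ∷ (- + 4420094 , - + 333592) ∷
                                  (+ 885661 , - + 455469) ∷ (+ 2918146 , - + 409640) ∷ (+ 5643869 , - + 219373) ∷ []))
  ∷ (231 , 4 , seed 118 46400
      (+ 44860 , + 780) ((+ 34520 , + 2040) ∷ (+ 13136 , + 2928) ∷ (- + 18665 , + 2795) ∷ (- + 28444 , + 2412) ∷
                         (- + 46000 , + 400) ∷ [])
      (- + 36991 , - + 1843) ((- + 29060 , - + 2380) ∷ (+ 1124 , - + 3052) ∷ (+ 25280 , - + 2560) ∷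
                              (+ 40240 , - + 1520) ∷ []))
  ∷ (455 , 5 , seed 76 4038336
      (+ 2639211 , + 143295) ((+ 1517454 , + 175446) ∷ (+ 635664 , + 186960) ∷ (+ 74376 , + 189288) ∷
                              (- + 1506996 , + 175644) ∷ (- + 4020624 , + 17712) ∷ [])
      (- + 3439836 , - + 99180) ((- + 2341674 , - + 154242) ∷ (- + 1860921 , - + 168021) ∷
                                 (- + 1005976 , - + 183352) ∷ (+ 1850904 , - + 168264) ∷
                                 (+ 3433914 , - + 99630) ∷ (+ 4024504 , - + 15656) ∷ []))
  ∷ (91 , 5 , seed 184 49446550
      (+ 49178555 , + 538935) ((+ 47110762 , + 1574304) ∷ (+ 21236550 , + 4681000) ∷ (+ 19683791 , + 4754997) ∷
                               (- + 28459395 , + 4238785) ∷ (- + 31081625 , + 4031325) ∷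
                               (- + 49175610 , + 541880) ∷ [])
      (- + 42972231 , - + 2564227) ((- + 41253085 , - + 2857695) ∷ (- + 30035125 , - + 4117575) ∷
                                    (+ 3475898 , - + 5170584) ∷ (+ 38380950 , - + 3268000) ∷
                                    (+ 43910565 , - + 2383145) ∷ []))
  ∷ (143 , 5 , seed 146 804384
      (+ 793516 , + 11020) ((+ 762342 , + 21462) ∷ (+ 546984 , + 49320) ∷ (+ 347928 , + 60648) ∷
                            (- + 393813 , + 58653) ∷ (- + 597016 , + 45080) ∷ (- + 793212 , + 11172) ∷ [])
      (- + 760608 , - + 21888) ((- + 637342 , - + 41038) ∷ (- + 583262 , - + 46322) ∷ (+ 35616 , - + 67200) ∷
                                (+ 600609 , - + 44745) ∷ (+ 678258 , - + 36162) ∷ []))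
  ∷ (715 , 5 , seed 347 42127610437778
      (+ 40422161829343 , + 443735563917) ((+ 39163381733913 , + 580529168251) ∷
                                           (+ 24123133572403 , + 1291613609895) ∷
                                           (- + 7927154014343 , + 1547339602917) ∷
                                           (- + 10427942854893 , + 1526453712263) ∷
                                           (- + 17362992190107 , + 1435446405263) ∷
                                           (- + 42009935548287 , + 117674889491) ∷ [])
      (- + 41629582370082 , - + 241537710472) ((- + 36787873870597 , - + 767693755665) ∷
                                               (+ 6389752413663 , - + 1557255351949) ∷
                                               (+ 9934797553403 , - + 1531047156975) ∷
                                               (+ 16898698384862 , - + 1443175187256) ∷
                                               (+ 19213555360722 , - + 1402083789680) ∷ []))
  ∷ (1155 , 4 , seed 685 288448412866
      (+ 287028106759 , + 841228135) ((+ 284255165819 , + 1441946613) ∷ (+ 266466055634 , + 3249818920) ∷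
                                      (+ 257902508719 , + 3801205423) ∷ (+ 156247538599 , + 7134404999) ∷
                                      (- + 272401576669 , + 2791432147) ∷ (- + 287949367169 , + 499045697) ∷ [])
      (- + 277581185026 , - + 2307745776) ((- + 276545213551 , - + 2413029521) ∷
                                           (- + 179578532509 , - + 6641991405) ∷
                                           (+ 42156499394 , - + 8396315232) ∷ []))
  ∷ (3003 , 5 , seed 185 500886036500573522
      (+ 419649917444209822 , + 4990192457478760) ((+ 177153279285916303 , + 8549546829053835) ∷
                                                   (+ 70055268010580651 , + 9050476002906919) ∷
                                                   (- + 27056980972889069 , + 9126971686625329) ∷
                                                   (- + 146147701027585459 , + 8742584908994449) ∷
                                                   (- + 498454625499840211 , + 899514776341361) ∷
                                                   (- + 500552557115420011 , + 333479385153511) ∷ [])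
      (- + 380096572324273006 , - + 5952789546602896) ((- + 289758369357495331 , - + 7455649956011871) ∷
                                                       (+ 154990513964874386 , - + 8691722576070864) ∷
                                                       (+ 264635236662799801 , - + 7760462587993469) ∷
                                                       (+ 341791375947068846 , - + 6681605229885984) ∷
                                                       (+ 413791214982053278 , - + 5150536149989080) ∷ []))
  ∷ (15015 , 5 , seed 1164 344306122222264
      (+ 336753658255736 , + 585294279840) ((+ 332154452714806 , + 739906004302) ∷
                                            (+ 322769762552959 , + 978162704499) ∷
                                            (- + 240145482685816 , + 2013554682784) ∷
                                            (- + 244013352760456 , + 1982342792928) ∷
                                            (- + 320698489198366 , + 1022529586346) ∷
                                            (- + 344260263655106 , + 45858567158) ∷ [])
      (- + 324616944859486 , - + 936567759510) ((- + 251811146689381 , - + 1916294504737) ∷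
                                                (- + 248070159761131 , - + 1948519962863) ∷
                                                (+ 318685944399544 , - + 1063610380928) ∷
                                                (+ 329018471466406 , - + 827980191618) ∷
                                                (+ 334233550220291 , - + 674675818201) ∷ []))
  ∷ [])

oddSeed : ℕ → ℕ × SeedData
oddSeed ν = search seedTable
  where
  search : List (ℕ × ℕ × SeedData) → ℕ × SeedData
  search [] = 0 , seed 0 0 0ᵥ [] 0ᵥ []
  search ((μ , entry) ∷ table) = if ν ≡ᵇ μ then entry else search table

Seeded : ℕ → Set
Seeded ν =
  Prime q × q ∣ ν × IsSeed ν (proj₂ (oddSeed ν)) × SeedData.size (proj₂ (oddSeed ν)) ≡ q × IsSeed ν (evenSeed ν)
  where
  q = 3 ℕ.+ 2 ℕ.* proj₁ (oddSeed ν)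

seeded? : ∀ ν → Dec (Seeded ν)
seeded? ν = prime? q ×-dec q ∣? ν ×-dec isSeed? ν (proj₂ (oddSeed ν)) ×-dec
            SeedData.size (proj₂ (oddSeed ν)) ℕP.≟ q ×-dec isSeed? ν (evenSeed ν)
  where
  q = 3 ℕ.+ 2 ℕ.* proj₁ (oddSeed ν)

seeded-divisors : All (λ ν → ν % 4 ≡ 3 → Seeded ν) (divisors smallPrimes)
seeded-divisors = toWitness {a? = all? (λ ν → (ν % 4 ℕP.≟ 3) →-dec seeded? ν) (divisors smallPrimes)} tt

seeded-polygons : ∀ {ν p} .{{_ : ℕ.NonZero ν}} → Seeded ν → (∀ q → Prime q → q ∣ ν → q ≤ p) →
  ∀ n → p ≤ n → ContainsConvexEquilateral (rectangular ν) n
seeded-polygons {ν} (q-prime , q∣ν , odd , size≡ , even) largest n p≤n =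
  polygons-from-seeds {s = proj₁ (oddSeed ν)} odd size≡ even n (ℕP.≤-trans (largest _ q-prime q∣ν) p≤n)

corollary3p4 : (L : IntegralLattice) (ν p : ℕ) → Nu L ν → ν % 4 ≡ 3
    → LargestPrimeFactor p ν → p < 17
    → (n : ℕ) → p ≤ n → ContainsConvexEquilateral L n
corollary3p4 L ν p nu@((0<ν , squareFree) , _) ν%4≡3 (_ , _ , largest) p<17 n p≤n with D²≡k²ν L nu
... | k , 0<k , D²≡ =
  Similarity.transfer L k {{ν≢0}} 0<k D²≡
    (seeded-polygons {{ν≢0}} (All.lookup seeded-divisors ν∈divisors ν%4≡3) largest n p≤n)
  where
  ν≢0 = ℕ.>-nonZero 0<ν
  ν∈divisors : ν ∈ divisors smallPrimes
  ν∈divisors = squareFree-∈-divisors smallPrimes (0<ν , squareFree)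
    (λ q q-prime q∣ν → prime<17⇒∈smallPrimes (ℕP.≤-<-trans (largest q q-prime q∣ν) p<17) q-prime)
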